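{- Let $p$ be a prime, $0\le a\le b$, $0\le c\le b-a$, $e\in\mathbb{Z}_{p^c}^*$, and let $\mathcal{A}=\mathcal{A}(p;a,b,c,e)$ be the regular dessin $(G,x,y)$ with $G=\langle x,y\mid x^{p^b}=y^{p^{a+c}}=[x,y]=1,\ y^{p^a}=x^{ep^{b-c}}\rangle$. Let $d=\gcd(p^{b-a},1+ep^{b-a-c})$. Then: (i) $\mathcal{A}$ is reflexible; (ii) the type of $\mathcal{A}$ is $(p^b,p^{a+c},p^b/d)$; (iii) the genus of $\mathcal{A}$ is $\frac12\left(2+p^a(p^b-p^{b-a-c}-d-1)\right)$; (iv) the underlying graph of $\mathcal{A}$ is the complete bipartite graph $K_{p^{b-c},p^a}^{(p^c)}$ of multiplicity $p^c$; (v) $\mathcal{A}$ is symmetric if and only if $c=b-a$ and $e^2\equiv1\pmod{p^c}$, in which case its underlying graph is $K_{p^a,p^a}^{(p^{b-a})}$.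
   Context: A regular dessin is a triple $(G,x,y)$ with $G$ a finite group generated by $x,y$. Its type is $(o(x),o(y),o(xy))$ and its genus $g$ is given by $2-2g=|G|\left(\frac1{o(x)}+\frac1{o(y)}+\frac1{o(xy)}-1\right)$. Its underlying graph is the bipartite multigraph whose vertices are the left cosets of $\langle x\rangle$ (black) and of $\langle y\rangle$ (white), and whose edges are the elements $h\in G$, the edge $h$ joining $h\langle x\rangle$ and $h\langle y\rangle$. $K_{n_1,n_2}^{(c)}$ denotes the complete bipartite graph with parts of sizes $n_1,n_2$ in which every pair of vertices from different parts is joined by exactly $c$ edges. The dessin is reflexible if $x\mapsto x^{ -1},y\mapsto y^{ -1}$ extends to an automorphism of $G$, and symmetric if $x\mapsto y,y\mapsto x$ does. -}

module Defs where

open import Level using (Level; _⊔_; 0ℓ)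
open import Data.Nat as ℕ using (ℕ; zero; suc; _∸_; NonZero)
open import Data.Nat.DivMod using (_/_)
open import Data.Nat.GCD using (gcd; gcd[m,n]≢0)
open import Data.Integer as ℤ using (ℤ; +_; _+_; _*_; -_; _-_)
import Data.Integer.Properties as ℤP
open import Data.Integer.Tactic.RingSolver using (solve-∀)
open import Data.Fin using (Fin)
open import Data.Unit using (⊤; tt)
open import Data.Product using (Σ; _×_; _,_; proj₁; proj₂)
open import Data.Sum using (_⊎_; inj₂)
open import Relation.Binary.PropositionalEquality
open import Algebra.Bundles using (Group)
open import Algebra.Structures using (IsGroup)
open import Algebra.Morphism.Structures using (module GroupMorphisms)

-- Counting: the quotient of {a | P a} by R has exactly n elements,
-- witnessed by a labelling of P-elements by Fin n which identifies
-- exactly the R-related elements and hits every label.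

Count : ∀ {a r q} {A : Set a} (R : A → A → Set r) (P : A → Set q) (n : ℕ) →
        Set (a ⊔ r ⊔ q)
Count {A = A} R P n =
  Σ ((u : A) → P u → Fin n) λ f →
    (∀ u v (pu : P u) (pv : P v) →
       (f u pu ≡ f v pv → R u v) × (R u v → f u pu ≡ f v pv))
    × (∀ i → Σ A λ u → Σ (P u) λ pu → f u pu ≡ i)

-- genus: 2 - 2g = n (1/ox + 1/oy + 1/oz - 1), denominators cleared
IsGenusOf : (n ox oy oz : ℕ) → ℤ → Set
IsGenusOf n ox oy oz g =
  (+ 2 - + 2 * g) * (+ ox * + oy * + oz)
    ≡ + n * (+ oy * + oz + + ox * + oz + + ox * + oy - + ox * + oy * + oz)

module DessinNotions {c ℓ} (G : Group c ℓ) where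
  open Group G
  open GroupMorphisms rawGroup rawGroup using (IsGroupIsomorphism)

  infixr 8 _^_
  _^_ : Carrier → ℕ → Carrier
  g ^ zero  = ε
  g ^ suc n = g ∙ (g ^ n)

  IsOrder : Carrier → ℕ → Set ℓ
  IsOrder g n = (0 ℕ.< n) × (g ^ n ≈ ε) ×
                (∀ m → 0 ℕ.< m → g ^ m ≈ ε → n ℕ.≤ m)

  HasCard : ℕ → Set (c ⊔ ℓ)
  HasCard n = Count _≈_ (λ _ → ⊤) n

  InCyc : Carrier → Carrier → Set ℓ
  InCyc z g = Σ ℕ λ k → (g ≈ z ^ k) ⊎ (g ≈ (z ^ k) ⁻¹)

  SameCoset : Carrier → Carrier → Carrier → Set ℓ
  SameCoset z g h = InCyc z (g ⁻¹ ∙ h)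

  HasGenus : Carrier → Carrier → ℤ → Set (c ⊔ ℓ)
  HasGenus x y g =
    Σ ℕ λ n → Σ ℕ λ ox → Σ ℕ λ oy → Σ ℕ λ oz →
      HasCard n × IsOrder x ox × IsOrder y oy × IsOrder (x ∙ y) oz ×
      IsGenusOf n ox oy oz g

  Reflexible : Carrier → Carrier → Set (c ⊔ ℓ)
  Reflexible x y = Σ (Carrier → Carrier) λ φ →
    IsGroupIsomorphism φ × (φ x ≈ x ⁻¹) × (φ y ≈ y ⁻¹)

  Symmetric : Carrier → Carrier → Set (c ⊔ ℓ)
  Symmetric x y = Σ (Carrier → Carrier) λ φ →
    IsGroupIsomorphism φ × (φ x ≈ y) × (φ y ≈ x)

  -- The underlying graph (black vertices = cosets of ⟨x⟩, white vertices
  -- = cosets of ⟨y⟩, edge h joins h⟨x⟩ and h⟨y⟩) has nB black and nW white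
  -- vertices and every black/white pair is joined by exactly m edges.
  CompleteBip : Carrier → Carrier → (nB nW m : ℕ) → Set (c ⊔ ℓ)
  CompleteBip x y nB nW m =
    Σ (Count (SameCoset x) (λ _ → ⊤) nB) λ B →
    Σ (Count (SameCoset y) (λ _ → ⊤) nW) λ W →
      ∀ i j → Count _≈_ (λ h → (proj₁ B h tt ≡ i) × (proj₁ W h tt ≡ j)) m

  -- underlying graph is (isomorphic to) K_{n₁,n₂}^{(m)}; the parts of
  -- K may correspond to either colour class.
  UnderlyingGraphIs : Carrier → Carrier → (n₁ n₂ m : ℕ) → Set (c ⊔ ℓ)
  UnderlyingGraphIs x y n₁ n₂ m = CompleteBip x y n₁ n₂ m ⊎ CompleteBip x y n₂ n₁ m

-- The abelian group ⟨x, y | x^P = y^Q = [x,y] = 1, y^R = x^E⟩ realised as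
-- ℤ² modulo the lattice spanned by (P,0), (0,Q), (-E,R).

private
  neg-lin : ∀ a X b Y → - (a * X + b * Y) ≡ (- a) * X + (- b) * Y
  neg-lin = solve-∀
  add-lin : ∀ a b c d X Y → (a * X + b * Y) + (c * X + d * Y) ≡ (a + c) * X + (b + d) * Y
  add-lin = solve-∀
  zero-lin : ∀ s X Y → s - s ≡ + 0 * X + + 0 * Y
  zero-lin = solve-∀
  flip-diff : ∀ i k → i - k ≡ - (k - i)
  flip-diff = solve-∀
  split-diff : ∀ i k m → m - i ≡ (m - k) + (k - i)
  split-diff = solve-∀
  sum-diff : ∀ a a' b b' → (a' + b') - (a + b) ≡ (a' - a) + (b' - b)
  sum-diff = solve-∀
  neg-diff : ∀ i k → (- k) - (- i) ≡ - (k - i)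
  neg-diff = solve-∀

module Quot (P Q R E : ℤ) where

  Carrier : Set
  Carrier = ℤ × ℤ

  InL : Carrier → Set
  InL (s , t) = Σ ℤ λ u → Σ ℤ λ v → Σ ℤ λ w →
    (s ≡ u * P + w * (- E)) × (t ≡ v * Q + w * R)

  _≈_ : Carrier → Carrier → Set
  (i , j) ≈ (k , l) = InL (k - i , l - j)

  _∙_ : Carrier → Carrier → Carrier
  (i , j) ∙ (k , l) = (i + k , j + l)

  ε : Carrier
  ε = (+ 0 , + 0)

  _⁻¹ : Carrier → Carrier
  (i , j) ⁻¹ = (- i , - j)

  ≡⇒≈ : ∀ {i j k l} → i ≡ k → j ≡ l → (i , j) ≈ (k , l)
  ≡⇒≈ {i} {j} refl refl = + 0 , + 0 , + 0 , zero-lin i P (- E) , zero-lin j Q R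

  ≈-sym : ∀ {a b} → a ≈ b → b ≈ a
  ≈-sym {i , j} {k , l} (u , v , w , h1 , h2) =
    - u , - v , - w ,
    trans (flip-diff i k) (trans (cong -_ h1) (neg-lin u P w (- E))) ,
    trans (flip-diff j l) (trans (cong -_ h2) (neg-lin v Q w R))

  ≈-trans : ∀ {a b d} → a ≈ b → b ≈ d → a ≈ d
  ≈-trans {i , j} {k , l} {m , n} (u , v , w , h1 , h2) (u' , v' , w' , h1' , h2') =
    u' + u , v' + v , w' + w ,
    trans (split-diff i k m) (trans (cong₂ _+_ h1' h1) (add-lin u' w' u w P (- E))) ,
    trans (split-diff j l n) (trans (cong₂ _+_ h2' h2) (add-lin v' w' v w Q R))

  ∙-cong : ∀ {a a' b b'} → a ≈ a' → b ≈ b' → (a ∙ b) ≈ (a' ∙ b')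
  ∙-cong {i , j} {i' , j'} {k , l} {k' , l'} (u , v , w , h1 , h2) (u' , v' , w' , h1' , h2') =
    u + u' , v + v' , w + w' ,
    trans (sum-diff i i' k k') (trans (cong₂ _+_ h1 h1') (add-lin u w u' w' P (- E))) ,
    trans (sum-diff j j' l l') (trans (cong₂ _+_ h2 h2') (add-lin v w v' w' Q R))

  ⁻¹-cong : ∀ {a b} → a ≈ b → (a ⁻¹) ≈ (b ⁻¹)
  ⁻¹-cong {i , j} {k , l} (u , v , w , h1 , h2) =
    - u , - v , - w ,
    trans (neg-diff i k) (trans (cong -_ h1) (neg-lin u P w (- E))) ,
    trans (neg-diff j l) (trans (cong -_ h2) (neg-lin v Q w R))

  isGroup : IsGroup _≈_ _∙_ ε _⁻¹
  isGroup = record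
    { isMonoid = record
      { isSemigroup = record
        { isMagma = record
          { isEquivalence = record
            { refl = λ { {i , j} → ≡⇒≈ {i} {j} {i} {j} refl refl }
            ; sym = λ {a} {b} → ≈-sym {a} {b}
            ; trans = λ {a} {b} {d} → ≈-trans {a} {b} {d} }
          ; ∙-cong = λ {a} {a'} {b} {b'} → ∙-cong {a} {a'} {b} {b'} }
        ; assoc = λ { (i , j) (k , l) (m , n) →
            ≡⇒≈ (ℤP.+-assoc i k m) (ℤP.+-assoc j l n) } }
      ; identity = (λ { (i , j) → ≡⇒≈ (ℤP.+-identityˡ i) (ℤP.+-identityˡ j) })
                 , (λ { (i , j) → ≡⇒≈ (ℤP.+-identityʳ i) (ℤP.+-identityʳ j) }) }
    ; inverse = (λ { (i , j) → ≡⇒≈ (ℤP.+-inverseˡ i) (ℤP.+-inverseˡ j) })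
              , (λ { (i , j) → ≡⇒≈ (ℤP.+-inverseʳ i) (ℤP.+-inverseʳ j) })
    ; ⁻¹-cong = λ {a} {b} → ⁻¹-cong {a} {b} }

  group : Group 0ℓ 0ℓ
  group = record { isGroup = isGroup }

DessinGroup : (p a b c e : ℕ) → Group 0ℓ 0ℓ
DessinGroup p a b c e =
  Quot.group (+ (p ℕ.^ b)) (+ (p ℕ.^ (a ℕ.+ c))) (+ (p ℕ.^ a))
             (+ (e ℕ.* p ℕ.^ (b ∸ c)))

genX : (p a b c e : ℕ) → Group.Carrier (DessinGroup p a b c e)
genX p a b c e = (+ 1 , + 0)

genY : (p a b c e : ℕ) → Group.Carrier (DessinGroup p a b c e)
genY p a b c e = (+ 0 , + 1)

dOf : (p a b c e : ℕ) → ℕ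
dOf p a b c e = gcd (p ℕ.^ (b ∸ a)) (suc (e ℕ.* p ℕ.^ (b ∸ a ∸ c)))

dOf-nonZero : ∀ p a b c e → NonZero (dOf p a b c e)
dOf-nonZero p a b c e =
    ℕ.≢-nonZero (gcd[m,n]≢0 (p ℕ.^ (b ∸ a)) (suc (e ℕ.* p ℕ.^ (b ∸ a ∸ c))) (inj₂ λ ()))

orderXY : (p a b c e : ℕ) → ℕ
orderXY p a b c e = _/_ (p ℕ.^ b) (dOf p a b c e) {{dOf-nonZero p a b c e}}

module Submission where

-- G is ℤ² modulo the lattice L spanned by (P,0), (0,Q), (−E,A), where A = p^a, C = p^c, S = p^(b−a−c),
-- W = AS, P = CW, Q = AC and E = eW.  Since (0,Q) = e(P,0) + C(−E,A), the lattice L consists of the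
-- points ((nC − me)W, mA), and every claim reduces to arithmetic in L.  Using y^A = x^E, each element
-- has the normal form x^i y^j with i mod P and j mod A, so |G| = PA; the cosets of ⟨x⟩ are read off
-- from j mod A and, by Bézout for e and C, those of ⟨y⟩ from i mod W, with C edges between any two.
-- Deciding when (k,0), (0,k) and (k,k) lie in L gives the orders P, AC and A·CS/d.  G is abelian, so
-- inversion witnesses reflexibility.  An automorphism swapping x and y turns y^(AC) = 1 into
-- x^(AC) = 1, forcing S = 1, and y^A = x^E into x^A = y^E, forcing e² ≡ 1 (mod C); conversely, under
-- these two conditions the coordinate swap preserves L.  The genus is the Riemann–Hurwitz count with
-- denominators cleared; it is an integer because A(P − S − d − 1) is even, by cases on the parity of p.

open import Defs
open import Algebra.Bundles using (Group)
open import Data.Nat.Base as ℕ using (ℕ)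
open import Relation.Binary.PropositionalEquality using (_≡_)

module EuclideanDivision where
  open import Data.Nat.Base using (zero; suc)
  import Data.Nat.Properties as ℕ
  open import Data.Integer.Base
  open import Data.Integer.Properties
  open import Data.Integer.DivMod using (_/ℕ_; _%ℕ_; n%ℕd<d; a≡a%ℕn+[a/ℕn]*n)
  open import Data.Integer.Tactic.RingSolver using (solve-∀)
  open import Data.Nat.Coprimality as Coprimality using (Coprime)
  open import Data.Nat.GCD using (module Bézout)
  open import Data.Product using (Σ; _×_; _,_; proj₁; proj₂)
  open import Data.Empty using (⊥-elim)
  open import Relation.Binary.PropositionalEquality

  private
    ∣+m-+n∣<d : ∀ {m n d} → m ℕ.< d → n ℕ.< d → ∣ + m - + n ∣ ℕ.< d
    ∣+m-+n∣<d {m} {n} m<d n<d = begin-strict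
      ∣ + m - + n ∣ ≡⟨ cong ∣_∣ (m-n≡m⊖n m n) ⟩
      ∣ m ⊖ n ∣     ≤⟨ ∣m⊝n∣≤m⊔n m n ⟩
      m ℕ.⊔ n       <⟨ ℕ.⊔-pres-<m m<d n<d ⟩
      _             ∎
      where open ℕ.≤-Reasoning

    ∣k*d∣<d⇒k≡0 : ∀ k d → ∣ k * + d ∣ ℕ.< d → k ≡ 0ℤ
    ∣k*d∣<d⇒k≡0 k d lt with ∣ k ∣ in ∣k∣≡ | subst (ℕ._< d) (abs-* k (+ d)) lt
    ... | zero  | _   = ∣i∣≡0⇒i≡0 ∣k∣≡
    ... | suc n | lt′ = ⊥-elim (ℕ.<-irrefl refl (ℕ.≤-<-trans (ℕ.m≤m+n d (n ℕ.* d)) lt′))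

  divmod-unique : ∀ i d .{{_ : ℕ.NonZero d}} r q → r ℕ.< d → i ≡ + r + q * + d →
                  (i %ℕ d ≡ r) × (i /ℕ d ≡ q)
  divmod-unique i d r q r<d i≡ = +-injective r₀≡r , sym q≡q₀
    where
      open ≡-Reasoning
      r₀ = i %ℕ d
      q₀ = i /ℕ d
      same : + r₀ + q₀ * + d ≡ + r + q * + d
      same = trans (sym (a≡a%ℕn+[a/ℕn]*n i d)) i≡
      rearrange : ∀ r₀ q₀ r q d → r₀ - r ≡ (q - q₀) * d + ((r₀ + q₀ * d) - (r + q * d))
      rearrange = solve-∀
      cancel : ∀ a b → a + (b - b) ≡ a
      cancel = solve-∀
      r₀-r≡ : + r₀ - + r ≡ (q - q₀) * + d
      r₀-r≡ = begin
        + r₀ - + r                                              ≡⟨ rearrange (+ r₀) q₀ (+ r) q (+ d) ⟩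
        (q - q₀) * + d + ((+ r₀ + q₀ * + d) - (+ r + q * + d)) ≡⟨ cong (λ j → (q - q₀) * + d + (j - (+ r + q * + d))) same ⟩
        (q - q₀) * + d + ((+ r + q * + d) - (+ r + q * + d))   ≡⟨ cancel ((q - q₀) * + d) (+ r + q * + d) ⟩
        (q - q₀) * + d                                          ∎
      q-q₀≡0 : q - q₀ ≡ 0ℤ
      q-q₀≡0 = ∣k*d∣<d⇒k≡0 (q - q₀) d
                 (subst (λ j → ∣ j ∣ ℕ.< d) r₀-r≡ (∣+m-+n∣<d (n%ℕd<d i d) r<d))
      q≡q₀ : q ≡ q₀
      q≡q₀ = i-j≡0⇒i≡j q q₀ q-q₀≡0
      r₀≡r : + r₀ ≡ + r
      r₀≡r = i-j≡0⇒i≡j (+ r₀) (+ r) (trans r₀-r≡ (cong (_* + d) q-q₀≡0))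

  [i+k*d]%ℕd≡i%ℕd : ∀ i k d .{{_ : ℕ.NonZero d}} → (i + k * + d) %ℕ d ≡ i %ℕ d
  [i+k*d]%ℕd≡i%ℕd i k d = proj₁ (divmod-unique (i + k * + d) d (i %ℕ d) (i /ℕ d + k) (n%ℕd<d i d) (begin
    i + k * + d                           ≡⟨ cong (_+ k * + d) (a≡a%ℕn+[a/ℕn]*n i d) ⟩
    + (i %ℕ d) + i /ℕ d * + d + k * + d   ≡⟨ regroup (+ (i %ℕ d)) (i /ℕ d) k (+ d) ⟩
    + (i %ℕ d) + (i /ℕ d + k) * + d       ∎))
    where
      open ≡-Reasoning
      regroup : ∀ r q k d → r + q * d + k * d ≡ r + (q + k) * d
      regroup = solve-∀

  %ℕ-≡⇒j≡i+[j/d-i/d]*d : ∀ i j d .{{_ : ℕ.NonZero d}} → i %ℕ d ≡ j %ℕ d →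
                          j ≡ i + (j /ℕ d - i /ℕ d) * + d
  %ℕ-≡⇒j≡i+[j/d-i/d]*d i j d eq = begin
    j                                                        ≡⟨ a≡a%ℕn+[a/ℕn]*n j d ⟩
    + (j %ℕ d) + j /ℕ d * + d                                ≡⟨ cong (λ r → + r + j /ℕ d * + d) (sym eq) ⟩
    + (i %ℕ d) + j /ℕ d * + d                                ≡⟨ regroup (+ (i %ℕ d)) (i /ℕ d) (j /ℕ d) (+ d) ⟩
    (+ (i %ℕ d) + i /ℕ d * + d) + (j /ℕ d - i /ℕ d) * + d   ≡⟨ cong (_+ (j /ℕ d - i /ℕ d) * + d) (a≡a%ℕn+[a/ℕn]*n i d) ⟨
    i + (j /ℕ d - i /ℕ d) * + d                              ∎
    where
      open ≡-Reasoning
      regroup : ∀ r q q′ d → r + q′ * d ≡ (r + q * d) + (q′ - q) * d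
      regroup = solve-∀

  n<d⇒+n%ℕd≡n : ∀ {n d} .{{_ : ℕ.NonZero d}} → n ℕ.< d → + n %ℕ d ≡ n
  n<d⇒+n%ℕd≡n {n} {d} n<d = proj₁ (divmod-unique (+ n) d n 0ℤ n<d (sym (+-identityʳ (+ n))))

  n<d⇒+n/ℕd≡0 : ∀ {n d} .{{_ : ℕ.NonZero d}} → n ℕ.< d → + n /ℕ d ≡ 0ℤ
  n<d⇒+n/ℕd≡0 {n} {d} n<d = proj₂ (divmod-unique (+ n) d n 0ℤ n<d (sym (+-identityʳ (+ n))))

  coprime⇒bézout : ∀ {m n} → Coprime m n → Σ ℤ λ α → Σ ℤ λ β → α * + n - β * + m ≡ 1ℤ
  coprime⇒bézout {m} {n} m⊥n with Coprimality.coprime-Bézout (Coprimality.sym m⊥n)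
  ... | Bézout.+- α β 1+βm≡αn = + α , + β , (begin
    + α * + n - + β * + m          ≡⟨ cong₂ _-_ (pos-* α n) (pos-* β m) ⟨
    + (α ℕ.* n) - + (β ℕ.* m)      ≡⟨ cong (λ z → + z - + (β ℕ.* m)) 1+βm≡αn ⟨
    + (1 ℕ.+ β ℕ.* m) - + (β ℕ.* m) ≡⟨ cong (_- + (β ℕ.* m)) (pos-+ 1 (β ℕ.* m)) ⟩
    1ℤ + + (β ℕ.* m) - + (β ℕ.* m)  ≡⟨ cancel 1ℤ (+ (β ℕ.* m)) ⟩
    1ℤ                              ∎)
    where
      open ≡-Reasoning
      cancel : ∀ a b → a + b - b ≡ a
      cancel = solve-∀
  ... | Bézout.-+ α β 1+αn≡βm = - + α , - + β , (begin
    - + α * + n - - + β * + m        ≡⟨ regroup (+ α) (+ n) (+ β) (+ m) ⟩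
    + β * + m - + α * + n            ≡⟨ cong₂ _-_ (pos-* β m) (pos-* α n) ⟨
    + (β ℕ.* m) - + (α ℕ.* n)        ≡⟨ cong (λ z → + z - + (α ℕ.* n)) 1+αn≡βm ⟨
    + (1 ℕ.+ α ℕ.* n) - + (α ℕ.* n)  ≡⟨ cong (_- + (α ℕ.* n)) (pos-+ 1 (α ℕ.* n)) ⟩
    1ℤ + + (α ℕ.* n) - + (α ℕ.* n)   ≡⟨ cancel 1ℤ (+ (α ℕ.* n)) ⟩
    1ℤ                               ∎)
    where
      open ≡-Reasoning
      cancel : ∀ a b → a + b - b ≡ a
      cancel = solve-∀
      regroup : ∀ a n b m → - a * n - - b * m ≡ b * m - a * n
      regroup = solve-∀

module GroupFacts {c ℓ} (G : Group c ℓ) where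
  open import Data.Nat.Base using (zero; suc)
  open import Data.Nat.Divisibility using (_∣_; ∣⇒≤)
  open import Algebra.Definitions using (Commutative)
  open import Algebra.Morphism.Structures using (module GroupMorphisms; module MagmaMorphisms)
  open import Data.Product using (_,_)
  open import Relation.Binary.Reasoning.Setoid (Group.setoid G)
  open Group G
  open DessinNotions G
  open import Algebra.Properties.Group G
  open GroupMorphisms rawGroup rawGroup using (IsGroupHomomorphism; IsGroupIsomorphism)
  open MagmaMorphisms rawMagma rawMagma using (IsMagmaHomomorphism)

  isOrder-from-∣ : ∀ {g n} → 0 ℕ.< n → g ^ n ≈ ε → (∀ k → g ^ k ≈ ε → n ∣ k) → IsOrder g n
  isOrder-from-∣ 0<n gⁿ≈ε n∣ = 0<n , gⁿ≈ε , λ k 0<k gᵏ≈ε → ∣⇒≤ {{ℕ.>-nonZero 0<k}} (n∣ k gᵏ≈ε)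

  ^-cong : ∀ {g h} n → g ≈ h → g ^ n ≈ h ^ n
  ^-cong zero    g≈h = refl
  ^-cong (suc n) g≈h = ∙-cong g≈h (^-cong n g≈h)

  module _ {φ : Carrier → Carrier} (φ-homo : IsGroupHomomorphism φ) where
    open IsGroupHomomorphism φ-homo

    homo-^ : ∀ g n → φ (g ^ n) ≈ φ g ^ n
    homo-^ g zero    = ε-homo
    homo-^ g (suc n) = trans (homo g (g ^ n)) (∙-cong refl (homo-^ g n))

    swap-^ : ∀ {g h} m n → φ g ≈ h → φ h ≈ g → g ^ m ≈ h ^ n → h ^ m ≈ g ^ n
    swap-^ {g} {h} m n φg≈h φh≈g gᵐ≈hⁿ = begin
      h ^ m     ≈⟨ ^-cong m φg≈h ⟨
      φ g ^ m   ≈⟨ homo-^ g m ⟨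
      φ (g ^ m) ≈⟨ ⟦⟧-cong gᵐ≈hⁿ ⟩
      φ (h ^ n) ≈⟨ homo-^ h n ⟩
      φ h ^ n   ≈⟨ ^-cong n φh≈g ⟩
      g ^ n     ∎

  involutive-homomorphism⇒isomorphism : ∀ {φ : Carrier → Carrier} → IsMagmaHomomorphism φ →
                                         (∀ g → φ (φ g) ≈ g) → IsGroupIsomorphism φ
  involutive-homomorphism⇒isomorphism {φ} φ-homo φφ≈id = record
    { isGroupMonomorphism = record
      { isGroupHomomorphism = record
        { isMonoidHomomorphism = record { isMagmaHomomorphism = φ-homo ; ε-homo = φε≈ε }
        ; ⁻¹-homo = λ g → inverseˡ-unique (φ (g ⁻¹)) (φ g) (begin
            φ (g ⁻¹) ∙ φ g ≈⟨ homo (g ⁻¹) g ⟨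
            φ (g ⁻¹ ∙ g)   ≈⟨ ⟦⟧-cong (inverseˡ g) ⟩
            φ ε            ≈⟨ φε≈ε ⟩
            ε              ∎) }
      ; injective = λ {g} {h} φg≈φh → begin
          g         ≈⟨ φφ≈id g ⟨
          φ (φ g)   ≈⟨ ⟦⟧-cong φg≈φh ⟩
          φ (φ h)   ≈⟨ φφ≈id h ⟩
          h         ∎ }
    ; surjective = λ h → φ h , λ {g} g≈φh → trans (⟦⟧-cong g≈φh) (φφ≈id h) }
    where
      open IsMagmaHomomorphism φ-homo
      φε≈ε : φ ε ≈ ε
      φε≈ε = identityˡ-unique (φ ε) (φ ε) (begin
        φ ε ∙ φ ε ≈⟨ homo ε ε ⟨
        φ (ε ∙ ε) ≈⟨ ⟦⟧-cong (identityˡ ε) ⟩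
        φ ε       ∎)

  ⁻¹-isGroupIsomorphism : Commutative _≈_ _∙_ → IsGroupIsomorphism _⁻¹
  ⁻¹-isGroupIsomorphism comm = involutive-homomorphism⇒isomorphism
    (record { isRelHomomorphism = record { cong = ⁻¹-cong }
            ; homo = λ g h → trans (⁻¹-anti-homo-∙ g h) (comm (h ⁻¹) (g ⁻¹)) })
    ⁻¹-involutive

module Parity where
  open import Data.Nat.Base
  open import Data.Nat.Properties using (m+[n∸m]≡n; +-suc; +-identityʳ)
  open import Data.Nat.Divisibility using (_∣_; divides; ∣-trans)
  open import Data.Nat.GCD using (gcd; gcd[m,n]∣m; gcd[m,n]∣n; gcd-greatest)
  open import Data.Nat.Coprimality using (Coprime)
  open import Data.Parity.Base as ℙ using (0ℙ; 1ℙ)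
  open import Data.Parity.Properties using (+-homo-+; *-homo-*; *-zeroʳ)
  open import Data.Product using (_,_)
  open import Relation.Binary.PropositionalEquality

  parity≡0ℙ⇒2∣ : ∀ n → parity n ≡ 0ℙ → 2 ∣ n
  parity≡0ℙ⇒2∣ zero          _  = divides 0 refl
  parity≡0ℙ⇒2∣ (suc (suc n)) eq with parity≡0ℙ⇒2∣ n eq
  ... | divides q n≡q*2 = divides (suc q) (cong (2 +_) n≡q*2)

  2∣⇒parity≡0ℙ : ∀ {n} → 2 ∣ n → parity n ≡ 0ℙ
  2∣⇒parity≡0ℙ (divides q refl) = trans (*-homo-* q 2) (*-zeroʳ (parity q))

  ∣-parity≡1ℙ : ∀ {d n} → d ∣ n → parity n ≡ 1ℙ → parity d ≡ 1ℙ
  ∣-parity≡1ℙ {d} d∣n n-odd with parity d in d-parity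
  ... | 1ℙ = refl
  ... | 0ℙ with trans (sym (2∣⇒parity≡0ℙ (∣-trans (parity≡0ℙ⇒2∣ d d-parity) d∣n))) n-odd
  ... | ()

  parity-^-odd : ∀ {m} → parity m ≡ 1ℙ → ∀ n → parity (m ^ n) ≡ 1ℙ
  parity-^-odd m-odd zero    = refl
  parity-^-odd {m} m-odd (suc n) = trans (*-homo-* m (m ^ n)) (cong₂ ℙ._*_ m-odd (parity-^-odd m-odd n))

  parity-^-even : ∀ {m} → parity m ≡ 0ℙ → ∀ n → parity (m ^ suc n) ≡ 0ℙ
  parity-^-even {m} m-even n = trans (*-homo-* m (m ^ n)) (cong (ℙ._* parity (m ^ n)) m-even)

  parity-numerator : ∀ A P S d → parity (A * (P + S + d + 1)) ≡
                     parity A ℙ.* (parity P ℙ.+ parity S ℙ.+ parity d ℙ.+ 1ℙ)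
  parity-numerator A P S d = trans (*-homo-* A _) (cong (parity A ℙ.*_)
    (trans (+-homo-+ (P + S + d) 1) (cong (ℙ._+ 1ℙ)
    (trans (+-homo-+ (P + S) d) (cong (ℙ._+ parity d) (+-homo-+ P S))))))

  private
    parity-1+m*n : ∀ m n → parity (suc (m * n)) ≡ 1ℙ ℙ.+ (parity m ℙ.* parity n)
    parity-1+m*n m n = trans (+-homo-+ 1 (m * n)) (cong (1ℙ ℙ.+_) (*-homo-* m n))

    coprime-to-even⇒odd : ∀ {e n} → Coprime e n → parity n ≡ 0ℙ → parity e ≡ 1ℙ
    coprime-to-even⇒odd {e} cop n-even with parity e in e-parity
    ... | 1ℙ = refl
    ... | 0ℙ with cop (parity≡0ℙ⇒2∣ e e-parity , parity≡0ℙ⇒2∣ _ n-even)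
    ... | ()

    parity-sum : ∀ P S d {x y z} → parity P ≡ x → parity S ≡ y → parity d ≡ z →
                 parity P ℙ.+ parity S ℙ.+ parity d ℙ.+ 1ℙ ≡ x ℙ.+ y ℙ.+ z ℙ.+ 1ℙ
    parity-sum _ _ _ refl refl refl = refl

    numerator-parity-a≡0 : ∀ {p} c s e → parity p ≡ 0ℙ → Coprime e (p ^ c) →
      parity (p ^ (c + s)) ℙ.+ parity (p ^ s) ℙ.+ parity (gcd (p ^ (c + s)) (suc (e * p ^ s))) ℙ.+ 1ℙ ≡ 0ℙ
    numerator-parity-a≡0 {p} c (suc s) e p-even _ = parity-sum P (p ^ suc s) d P-even S-even d-odd
      where
        P = p ^ (c + suc s)
        d = gcd P (suc (e * p ^ suc s))
        P-even : parity P ≡ 0ℙ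
        P-even = subst (λ k → parity (p ^ k) ≡ 0ℙ) (sym (+-suc c s)) (parity-^-even {p} p-even (c + s))
        S-even : parity (p ^ suc s) ≡ 0ℙ
        S-even = parity-^-even {p} p-even s
        d-odd : parity d ≡ 1ℙ
        d-odd = ∣-parity≡1ℙ {d} (gcd[m,n]∣n P (suc (e * p ^ suc s)))
                  (trans (parity-1+m*n e (p ^ suc s))
                    (cong (1ℙ ℙ.+_) (trans (cong (parity e ℙ.*_) S-even) (*-zeroʳ (parity e)))))
    numerator-parity-a≡0 {p} zero zero e p-even _ =
      parity-sum 1 1 (gcd 1 (suc (e * 1))) refl refl (∣-parity≡1ℙ {gcd 1 (suc (e * 1))} (gcd[m,n]∣m 1 (suc (e * 1))) refl)
    numerator-parity-a≡0 {p} (suc c) zero e p-even cop = parity-sum P 1 d P-even refl d-even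
      where
        P = p ^ (suc c + 0)
        d = gcd P (suc (e * 1))
        C-even : parity (p ^ suc c) ≡ 0ℙ
        C-even = parity-^-even {p} p-even c
        P-even : parity P ≡ 0ℙ
        P-even = subst (λ k → parity (p ^ k) ≡ 0ℙ) (sym (+-identityʳ (suc c))) C-even
        1+e-even : parity (suc (e * 1)) ≡ 0ℙ
        1+e-even = trans (parity-1+m*n e 1) (cong (λ q → 1ℙ ℙ.+ (q ℙ.* 1ℙ)) (coprime-to-even⇒odd cop C-even))
        d-even : parity d ≡ 0ℙ
        d-even = 2∣⇒parity≡0ℙ (gcd-greatest (parity≡0ℙ⇒2∣ P P-even) (parity≡0ℙ⇒2∣ (suc (e * 1)) 1+e-even))

    numerator-parity≡0ℙ : ∀ p a b c e → c ≤ b ∸ a → Coprime e (p ^ c) →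
      parity (p ^ a) ℙ.* (parity (p ^ b) ℙ.+ parity (p ^ (b ∸ a ∸ c)) ℙ.+ parity (dOf p a b c e) ℙ.+ 1ℙ) ≡ 0ℙ
    numerator-parity≡0ℙ p a b c e c≤ cop with parity p in p-parity
    numerator-parity≡0ℙ p a b c e c≤ cop | 1ℙ =
      cong₂ ℙ._*_ (parity-^-odd {p} p-parity a)
        (parity-sum (p ^ b) (p ^ (b ∸ a ∸ c)) (dOf p a b c e)
          (parity-^-odd {p} p-parity b) (parity-^-odd {p} p-parity (b ∸ a ∸ c))
          (∣-parity≡1ℙ {dOf p a b c e} (gcd[m,n]∣m (p ^ (b ∸ a)) (suc (e * p ^ (b ∸ a ∸ c))))
                                       (parity-^-odd {p} p-parity (b ∸ a))))
    numerator-parity≡0ℙ p (suc a) b c e c≤ cop | 0ℙ rewrite parity-^-even {p} p-parity a = refl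
    numerator-parity≡0ℙ p zero b c e c≤ cop | 0ℙ =
      subst (λ b′ → parity (p ^ b′) ℙ.+ parity (p ^ (b ∸ c))
                      ℙ.+ parity (gcd (p ^ b′) (suc (e * p ^ (b ∸ c)))) ℙ.+ 1ℙ ≡ 0ℙ)
            (m+[n∸m]≡n c≤) (numerator-parity-a≡0 c (b ∸ c) e p-parity cop)

  -- The numerator has the parity of 2g − 2 = p^a (p^b − p^(b−a−c) − d − 1).
  genus-numerator-even : ∀ p a b c e → c ≤ b ∸ a → Coprime e (p ^ c) →
                         2 ∣ p ^ a * (p ^ b + p ^ (b ∸ a ∸ c) + dOf p a b c e + 1)
  genus-numerator-even p a b c e c≤ cop = parity≡0ℙ⇒2∣ _
    (trans (parity-numerator (p ^ a) (p ^ b) (p ^ (b ∸ a ∸ c)) (dOf p a b c e)) (numerator-parity≡0ℙ p a b c e c≤ cop))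

module GenusArithmetic where
  open import Data.Nat.Divisibility using (_∣_; divides)
  open import Data.Integer.Base
  open import Data.Integer.Properties using (pos-*)
  open import Data.Integer.Tactic.RingSolver using (solve-∀)
  open import Data.Product using (Σ; _,_)
  open import Relation.Binary.PropositionalEquality
  open ≡-Reasoning

  even-numerator⇒genus : ∀ a P S d → 2 ∣ a ℕ.* (P ℕ.+ S ℕ.+ d ℕ.+ 1) →
                         Σ ℤ λ g → + 2 * g ≡ + 2 + + a * (+ P - + S - + d - + 1)
  even-numerator⇒genus a P S d (divides k a[P+S+d+1]≡k*2) = 1ℤ + + k - + a * (+ S + + d + 1ℤ) , (begin
    + 2 * (1ℤ + + k - + a * (+ S + + d + 1ℤ))                    ≡⟨ expand (+ a) (+ S) (+ d) (+ k) ⟩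
    + 2 + + k * + 2 - + 2 * (+ a * (+ S + + d + 1ℤ))             ≡⟨ cong (λ z → + 2 + z - + 2 * (+ a * (+ S + + d + 1ℤ))) k*2≡ ⟨
    + 2 + + a * (+ P + + S + + d + 1ℤ) - + 2 * (+ a * (+ S + + d + 1ℤ)) ≡⟨ collect (+ a) (+ P) (+ S) (+ d) ⟩
    + 2 + + a * (+ P - + S - + d - + 1)                          ∎)
    where
      expand : ∀ a S d k → + 2 * (1ℤ + k - a * (S + d + 1ℤ)) ≡ + 2 + k * + 2 - + 2 * (a * (S + d + 1ℤ))
      expand = solve-∀
      collect : ∀ a P S d → + 2 + a * (P + S + d + 1ℤ) - + 2 * (a * (S + d + 1ℤ)) ≡ + 2 + a * (P - S - d - + 1)
      collect = solve-∀
      k*2≡ : + a * (+ P + + S + + d + 1ℤ) ≡ + k * + 2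
      k*2≡ = trans (sym (pos-* a (P ℕ.+ S ℕ.+ d ℕ.+ 1))) (trans (cong +_ a[P+S+d+1]≡k*2) (pos-* k 2))

  genus-formula : ∀ a c s d n′ g {P Q Z n} → P ≡ c * (a * s) → Q ≡ a * c → Z ≡ a * n′ → n ≡ P * a →
                  c * s ≡ d * n′ → + 2 * g ≡ + 2 + a * (P - s - d - + 1) →
                  (+ 2 - + 2 * g) * (P * Q * Z) ≡ n * (Q * Z + P * Z + P * Q - P * Q * Z)
  genus-formula a c s d n′ g refl refl refl refl cs≡dn′ 2g≡ = begin
    (+ 2 - + 2 * g) * (P * Q * Z)                        ≡⟨ cong (λ z → (+ 2 - z) * (P * Q * Z)) 2g≡ ⟩
    (+ 2 - (+ 2 + a * (P - s - d - + 1))) * (P * Q * Z)  ≡⟨ expand a c s d n′ ⟩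
    rhs + K * (d * n′ - c * s)                           ≡⟨ cong (λ z → rhs + K * (d * n′ - z)) cs≡dn′ ⟩
    rhs + K * (d * n′ - d * n′)                          ≡⟨ vanish rhs K (d * n′) ⟩
    rhs                                                  ∎
    where
      P Q Z n K rhs : ℤ
      P = c * (a * s)
      Q = a * c
      Z = a * n′
      n = P * a
      K = P * a * a * a * c
      rhs = n * (Q * Z + P * Z + P * Q - P * Q * Z)
      expand : ∀ a c s d n′ → (+ 2 - (+ 2 + a * (c * (a * s) - s - d - + 1))) * (c * (a * s) * (a * c) * (a * n′)) ≡
               c * (a * s) * a * (a * c * (a * n′) + c * (a * s) * (a * n′) + c * (a * s) * (a * c) - c * (a * s) * (a * c) * (a * n′))
                 + c * (a * s) * a * a * a * c * (d * n′ - c * s)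
      expand = solve-∀
      vanish : ∀ x k m → x + k * (m - m) ≡ x
      vanish = solve-∀

module AbelianDessin (A C S e : ℕ) {{A≢0 : ℕ.NonZero A}} {{C≢0 : ℕ.NonZero C}} {{S≢0 : ℕ.NonZero S}}
                     {P Q E : ℕ} (P≡ : P ≡ C ℕ.* (A ℕ.* S)) (Q≡ : Q ≡ A ℕ.* C) (E≡ : E ≡ e ℕ.* (A ℕ.* S)) where
  import Data.Nat.Properties as ℕ
  import Data.Nat.Divisibility as ℕ
  open import Data.Nat.Coprimality as Coprimality using (Coprime)
  open import Data.Integer.Base hiding (_^_)
  open import Data.Integer.Properties
  open import Data.Integer.Divisibility using () renaming (_∣_ to _∣ᵤ_)
  open import Data.Integer.Divisibility.Signed as Signed using (divides; ∣⇒∣ᵤ; ∣ᵤ⇒∣)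
  import Data.Integer.Coprimality as ℤ
  open import Data.Integer.Tactic.RingSolver using (solve-∀)
  open import Data.Integer.DivMod using (_/ℕ_; _%ℕ_; n%ℕd<d; a≡a%ℕn+[a/ℕn]*n)
  open import Data.Fin.Base using (Fin; toℕ; fromℕ<; combine; remQuot; quotient; remainder)
  import Data.Fin.Properties as Fin
  open import Data.Product using (Σ; _×_; _,_; proj₁; proj₂)
  open import Data.Sum using (inj₁; inj₂)
  open import Data.Unit using (⊤; tt)
  open import Relation.Binary.PropositionalEquality
  open import Algebra.Definitions using (Commutative)
  open EuclideanDivision
  open GenusArithmetic
  open import Algebra.Morphism.Structures using (module GroupMorphisms; module MagmaMorphisms)
  open import Function.Bundles using (_⇔_; mk⇔)

  W : ℕ
  W = A ℕ.* S

  instance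
    W≢0 : ℕ.NonZero W
    W≢0 = ℕ.m*n≢0 A S
    CW≢0 : ℕ.NonZero (C ℕ.* W)
    CW≢0 = ℕ.m*n≢0 C W
    AC≢0 : ℕ.NonZero (A ℕ.* C)
    AC≢0 = ℕ.m*n≢0 A C

  +P≡ : + P ≡ + C * + W
  +P≡ = trans (cong +_ P≡) (pos-* C W)

  +Q≡ : + Q ≡ + A * + C
  +Q≡ = trans (cong +_ Q≡) (pos-* A C)

  +E≡ : + E ≡ + e * + W
  +E≡ = trans (cong +_ E≡) (pos-* e W)

  +W≡ : + W ≡ + A * + S
  +W≡ = pos-* A S

  G : Group _ _
  G = Quot.group (+ P) (+ Q) (+ A) (+ E)

  open Quot (+ P) (+ Q) (+ A) (+ E) using (InL; ≡⇒≈)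
  open Group G using (Carrier; _≈_; _∙_; ε; _⁻¹) renaming (refl to ≈-refl)
  open DessinNotions G
  open GroupFacts G

  x y : Carrier
  x = (+ 1 , + 0)
  y = (+ 0 , + 1)

  InLattice : ℤ → ℤ → Set
  InLattice s t = Σ ℤ λ n → Σ ℤ λ m → (s ≡ (n * + C - m * + e) * + W) × (t ≡ m * + A)

  InL⇒InLattice : ∀ {s t} → InL (s , t) → InLattice s t
  InL⇒InLattice {s} {t} (u , v , w , s≡ , t≡) = u + v * + e , v * + C + w ,
    trans s≡ (trans (cong₂ (λ P E → u * P + w * (- E)) +P≡ +E≡) (regroupˢ u v w (+ C) (+ e) (+ W))) ,
    trans t≡ (trans (cong (λ Q → v * Q + w * + A) +Q≡) (regroupᵗ v w (+ A) (+ C)))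
    where
      regroupˢ : ∀ u v w c e W → u * (c * W) + w * (- (e * W)) ≡ ((u + v * e) * c - (v * c + w) * e) * W
      regroupˢ = solve-∀
      regroupᵗ : ∀ v w a c → v * (a * c) + w * a ≡ (v * c + w) * a
      regroupᵗ = solve-∀

  InLattice⇒InL : ∀ {s t} → InLattice s t → InL (s , t)
  InLattice⇒InL {s} {t} (n , m , s≡ , t≡) = n , 0ℤ , m ,
    trans s≡ (trans (regroupˢ n m (+ C) (+ e) (+ W)) (sym (cong₂ (λ P E → n * P + m * (- E)) +P≡ +E≡))) ,
    trans t≡ (regroupᵗ m (+ Q) (+ A))
    where
      regroupˢ : ∀ n m c e W → (n * c - m * e) * W ≡ n * (c * W) + m * (- (e * W))
      regroupˢ = solve-∀
      regroupᵗ : ∀ m Q a → m * a ≡ 0ℤ * Q + m * a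
      regroupᵗ = solve-∀

  ≈ε⇒InLattice : ∀ i j → (i , j) ≈ ε → InLattice (- i) (- j)
  ≈ε⇒InLattice i j i,j≈ε = subst₂ InLattice (+-identityˡ (- i)) (+-identityˡ (- j)) (InL⇒InLattice i,j≈ε)

  InLattice⇒≈ε : ∀ i j → InLattice (- i) (- j) → (i , j) ≈ ε
  InLattice⇒≈ε i j lat = InLattice⇒InL (subst₂ InLattice (sym (+-identityˡ (- i))) (sym (+-identityˡ (- j))) lat)

  x^≡ : ∀ n → x ^ n ≡ (+ n , 0ℤ)
  x^≡ ℕ.zero    = refl
  x^≡ (ℕ.suc n) = cong (x ∙_) (x^≡ n)

  y^≡ : ∀ n → y ^ n ≡ (0ℤ , + n)
  y^≡ ℕ.zero    = refl
  y^≡ (ℕ.suc n) = cong (y ∙_) (y^≡ n)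

  [xy]^≡ : ∀ n → (x ∙ y) ^ n ≡ (+ n , + n)
  [xy]^≡ ℕ.zero    = refl
  [xy]^≡ (ℕ.suc n) = cong ((x ∙ y) ∙_) ([xy]^≡ n)

  private
    -k≡q*d⇒d∣k : ∀ {d k} q → - + k ≡ q * + d → d ℕ.∣ k
    -k≡q*d⇒d∣k {d} {k} q -k≡ = ∣⇒∣ᵤ (divides (- q) (begin
      + k         ≡⟨ neg-involutive (+ k) ⟨
      - - + k     ≡⟨ cong -_ -k≡ ⟩
      - (q * + d) ≡⟨ neg-distribˡ-* q (+ d) ⟩
      - q * + d   ∎))
      where open ≡-Reasoning

    i*W≡0⇒i≡0 : ∀ i → 0ℤ ≡ i * + W → i ≡ 0ℤ
    i*W≡0⇒i≡0 i 0≡ = *-cancelʳ-≡ i 0ℤ (+ W) (sym 0≡)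

  xᶜᵂ≈ε : x ^ (C ℕ.* W) ≈ ε
  xᶜᵂ≈ε = subst (_≈ ε) (sym (x^≡ (C ℕ.* W))) (InLattice⇒≈ε (+ (C ℕ.* W)) 0ℤ (-1ℤ , 0ℤ ,
    trans (cong -_ (pos-* C W)) (regroup (+ C) (+ e) (+ W)) , refl))
    where
      regroup : ∀ c e W → - (c * W) ≡ (-1ℤ * c - 0ℤ * e) * W
      regroup = solve-∀

  xᵏ≈ε⇒CW∣k : ∀ k → x ^ k ≈ ε → C ℕ.* W ℕ.∣ k
  xᵏ≈ε⇒CW∣k k xᵏ≈ε with ≈ε⇒InLattice (+ k) 0ℤ (subst (_≈ ε) (x^≡ k) xᵏ≈ε)
  ... | n , m , -k≡ , 0≡mA = -k≡q*d⇒d∣k n (begin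
    - + k                         ≡⟨ -k≡ ⟩
    (n * + C - m * + e) * + W     ≡⟨ cong (λ m → (n * + C - m * + e) * + W) m≡0 ⟩
    (n * + C - 0ℤ * + e) * + W    ≡⟨ regroup n (+ C) (+ e) (+ W) ⟩
    n * (+ C * + W)               ≡⟨ cong (n *_) (pos-* C W) ⟨
    n * + (C ℕ.* W)               ∎)
    where
      open ≡-Reasoning
      m≡0 : m ≡ 0ℤ
      m≡0 = *-cancelʳ-≡ m 0ℤ (+ A) (sym 0≡mA)
      regroup : ∀ n c e W → (n * c - 0ℤ * e) * W ≡ n * (c * W)
      regroup = solve-∀

  order-x : IsOrder x P
  order-x = subst (IsOrder x) (sym P≡) (isOrder-from-∣ (ℕ.>-nonZero⁻¹ (C ℕ.* W)) xᶜᵂ≈ε xᵏ≈ε⇒CW∣k)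

  yᴬᶜ≈ε : y ^ (A ℕ.* C) ≈ ε
  yᴬᶜ≈ε = subst (_≈ ε) (sym (y^≡ (A ℕ.* C))) (InLattice⇒≈ε 0ℤ (+ (A ℕ.* C)) (- + e , - + C ,
    regroupˢ (+ C) (+ e) (+ W) , trans (cong -_ (pos-* A C)) (regroupᵗ (+ A) (+ C))))
    where
      regroupˢ : ∀ c e W → - 0ℤ ≡ ((- e) * c - (- c) * e) * W
      regroupˢ = solve-∀
      regroupᵗ : ∀ a c → - (a * c) ≡ (- c) * a
      regroupᵗ = solve-∀

  yᵏ≈ε⇒AC∣k : Coprime e C → ∀ k → y ^ k ≈ ε → A ℕ.* C ℕ.∣ k
  yᵏ≈ε⇒AC∣k e⊥C k yᵏ≈ε with ≈ε⇒InLattice 0ℤ (+ k) (subst (_≈ ε) (y^≡ k) yᵏ≈ε)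
  ... | n , m , 0≡ , -k≡mA = -k≡q*d⇒d∣k q (begin
    - + k            ≡⟨ -k≡mA ⟩
    m * + A          ≡⟨ cong (_* + A) m≡qC ⟩
    q * + C * + A    ≡⟨ regroup q (+ C) (+ A) ⟩
    q * (+ A * + C)  ≡⟨ cong (q *_) (pos-* A C) ⟨
    q * + (A ℕ.* C)  ∎)
    where
      open ≡-Reasoning
      regroup : ∀ q c a → q * c * a ≡ q * (a * c)
      regroup = solve-∀
      nC≡me : n * + C ≡ m * + e
      nC≡me = i-j≡0⇒i≡j _ _ (i*W≡0⇒i≡0 _ 0≡)
      C∣m : + C Signed.∣ m
      C∣m = ∣ᵤ⇒∣ (ℤ.coprime-divisor (+ C) (+ e) m (Coprimality.sym e⊥C)
              (∣⇒∣ᵤ (divides n (trans (*-comm (+ e) m) (sym nC≡me)))))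
      q : ℤ
      q = Signed._∣_.quotient C∣m
      m≡qC : m ≡ q * + C
      m≡qC = Signed._∣_.equality C∣m

  order-y : Coprime e C → IsOrder y Q
  order-y e⊥C = subst (IsOrder y) (sym Q≡) (isOrder-from-∣ (ℕ.>-nonZero⁻¹ (A ℕ.* C)) yᴬᶜ≈ε (yᵏ≈ε⇒AC∣k e⊥C))

  ∙-comm : Commutative _≈_ _∙_
  ∙-comm (i , j) (k , l) = ≡⇒≈ (+-comm i k) (+-comm j l)

  reflexible : Reflexible x y
  reflexible = _⁻¹ , ⁻¹-isGroupIsomorphism ∙-comm , ≈-refl {x ⁻¹} , ≈-refl {y ⁻¹}

  yᴬ≈xᴱ : y ^ A ≈ x ^ E
  yᴬ≈xᴱ = subst₂ _≈_ (sym (y^≡ A)) (sym (x^≡ E)) (InLattice⇒InL (0ℤ , -1ℤ ,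
    trans (+-identityʳ (+ E)) (trans +E≡ (regroupˢ (+ C) (+ e) (+ W))) ,
    trans (+-identityˡ (- + A)) (regroupᵗ (+ A))))
    where
      regroupˢ : ∀ c e W → e * W ≡ (0ℤ * c - -1ℤ * e) * W
      regroupˢ = solve-∀
      regroupᵗ : ∀ a → - a ≡ -1ℤ * a
      regroupᵗ = solve-∀

  module _ (S≡1 : S ≡ 1) where

    +W≡+A : + W ≡ + A
    +W≡+A = cong +_ (trans (cong (A ℕ.*_) S≡1) (ℕ.*-identityʳ A))

    InLattice-swap : + C ∣ᵤ (+ (e ℕ.* e) - + 1) → ∀ {s t} → InLattice s t → InLattice t s
    InLattice-swap C∣e²-1 {s} {t} (n , m , s≡ , t≡) = n * + e - m * h , n * + C - m * + e ,
      (begin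
        t                                                     ≡⟨ t≡ ⟩
        m * + A                                               ≡⟨ cong (m *_) +W≡+A ⟨
        m * + W                                               ≡⟨ cong (_* + W) (*-identityʳ m) ⟨
        m * 1ℤ * + W                                          ≡⟨ cong (λ z → m * z * + W) e²-hC≡1 ⟨
        m * (+ e * + e - h * + C) * + W                       ≡⟨ regroup n m h (+ C) (+ e) (+ W) ⟩
        ((n * + e - m * h) * + C - (n * + C - m * + e) * + e) * + W ∎) ,
      trans s≡ (cong ((n * + C - m * + e) *_) +W≡+A)
      where
        open ≡-Reasoning
        C∣ₛe²-1 : + C Signed.∣ (+ (e ℕ.* e) - + 1)
        C∣ₛe²-1 = ∣ᵤ⇒∣ C∣e²-1
        h : ℤ
        h = Signed._∣_.quotient C∣ₛe²-1
        e²-1≡hC : + (e ℕ.* e) - + 1 ≡ h * + C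
        e²-1≡hC = Signed._∣_.equality C∣ₛe²-1
        cancel : ∀ a b → a - (a - b) ≡ b
        cancel = solve-∀
        regroup : ∀ n m h c e w → m * (e * e - h * c) * w ≡ ((n * e - m * h) * c - (n * c - m * e) * e) * w
        regroup = solve-∀
        e²-hC≡1 : + e * + e - h * + C ≡ 1ℤ
        e²-hC≡1 = begin
          + e * + e - h * + C                 ≡⟨ cong (λ z → z - h * + C) (pos-* e e) ⟨
          + (e ℕ.* e) - h * + C               ≡⟨ cong (λ z → + (e ℕ.* e) - z) e²-1≡hC ⟨
          + (e ℕ.* e) - (+ (e ℕ.* e) - + 1)   ≡⟨ cancel (+ (e ℕ.* e)) (+ 1) ⟩
          1ℤ                                  ∎

  symmetric⇒ : Coprime e C → Symmetric x y → S ≡ 1 × + C ∣ᵤ (+ (e ℕ.* e) - + 1)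
  symmetric⇒ e⊥C (φ , φ-iso , φx≈y , φy≈x) = S≡1 , C∣e²-1
    where
      open GroupMorphisms (Group.rawGroup G) (Group.rawGroup G)
        using (IsGroupHomomorphism; module IsGroupIsomorphism)
      φ-homo : IsGroupHomomorphism φ
      φ-homo = IsGroupIsomorphism.isGroupHomomorphism φ-iso
      CAS∣CA1 : C ℕ.* A ℕ.* S ℕ.∣ C ℕ.* A ℕ.* 1
      CAS∣CA1 = subst₂ ℕ._∣_ (sym (ℕ.*-assoc C A S)) (trans (ℕ.*-comm A C) (sym (ℕ.*-identityʳ (C ℕ.* A))))
                  (xᵏ≈ε⇒CW∣k (A ℕ.* C) (swap-^ φ-homo (A ℕ.* C) 0 φy≈x φx≈y yᴬᶜ≈ε))
      S≡1 : S ≡ 1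
      S≡1 = ℕ.∣1⇒≡1 (ℕ.*-cancelˡ-∣ (C ℕ.* A) {{ℕ.m*n≢0 C A}} CAS∣CA1)
      xᴬ≈yᴱ : x ^ A ≈ y ^ E
      xᴬ≈yᴱ = swap-^ φ-homo A E φy≈x φx≈y yᴬ≈xᴱ
      C∣e²-1 : + C ∣ᵤ (+ (e ℕ.* e) - + 1)
      C∣e²-1 = lattice⇒C∣e²-1 (InL⇒InLattice (subst₂ _≈_ (x^≡ A) (y^≡ E) xᴬ≈yᴱ))
        where
          lattice⇒C∣e²-1 : InLattice (0ℤ - + A) (+ E - 0ℤ) → + C ∣ᵤ (+ (e ℕ.* e) - + 1)
          lattice⇒C∣e²-1 (n , m , -A≡ , E≡mA) = ∣⇒∣ᵤ (divides n (begin
            + (e ℕ.* e) - + 1                  ≡⟨ cong (_- + 1) (pos-* e e) ⟩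
            + e * + e - + 1                    ≡⟨ cong (λ z → + e * + e + z) -1≡ ⟩
            + e * + e + (n * + C - + e * + e)  ≡⟨ regroup (+ e * + e) (n * + C) ⟩
            n * + C                            ∎))
            where
              open ≡-Reasoning
              regroup : ∀ a b → a + (b - a) ≡ b
              regroup = solve-∀
              -1*a≡0-a : ∀ a → -1ℤ * a ≡ 0ℤ - a
              -1*a≡0-a = solve-∀
              m≡e : m ≡ + e
              m≡e = *-cancelʳ-≡ m (+ e) (+ A) (begin
                m * + A    ≡⟨ E≡mA ⟨
                + E - 0ℤ   ≡⟨ +-identityʳ (+ E) ⟩
                + E        ≡⟨ +E≡ ⟩
                + e * + W  ≡⟨ cong (+ e *_) (+W≡+A S≡1) ⟩
                + e * + A  ∎)
              -1≡ : -1ℤ ≡ n * + C - + e * + e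
              -1≡ = *-cancelʳ-≡ -1ℤ _ (+ A) (begin
                -1ℤ * + A                    ≡⟨ -1*a≡0-a (+ A) ⟩
                0ℤ - + A                     ≡⟨ -A≡ ⟩
                (n * + C - m * + e) * + W    ≡⟨ cong₂ (λ m w → (n * + C - m * + e) * w) m≡e (+W≡+A S≡1) ⟩
                (n * + C - + e * + e) * + A  ∎)

  symmetric⇐ : S ≡ 1 → + C ∣ᵤ (+ (e ℕ.* e) - + 1) → Symmetric x y
  symmetric⇐ S≡1 C∣e²-1 = swap , involutive-homomorphism⇒isomorphism swap-homo (λ g → ≈-refl {g}) , ≈-refl {y} , ≈-refl {x}
    where
      open MagmaMorphisms (Group.rawMagma G) (Group.rawMagma G) using (IsMagmaHomomorphism)
      swap : Carrier → Carrier
      swap (i , j) = (j , i)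
      swap-homo : IsMagmaHomomorphism swap
      swap-homo = record
        { isRelHomomorphism = record
          { cong = λ {u} {v} u≈v → InLattice⇒InL (InLattice-swap S≡1 C∣e²-1 (InL⇒InLattice u≈v)) }
        ; homo = λ u v → ≈-refl {swap (u ∙ v)} }

  symmetric⇔ : Coprime e C → Symmetric x y ⇔ (S ≡ 1 × + C ∣ᵤ (+ (e ℕ.* e) - + 1))
  symmetric⇔ e⊥C = mk⇔ (symmetric⇒ e⊥C) λ (S≡1 , C∣e²-1) → symmetric⇐ S≡1 C∣e²-1

  -- x^i y^j = x^(i + ⌊j/A⌋E) y^(j mod A), since y^A = x^E.
  expX : Carrier → ℕ
  expX (i , j) = (i + j /ℕ A * + E) %ℕ (C ℕ.* W)

  expY : Carrier → ℕ
  expY (i , j) = j %ℕ A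

  normal-form-cong : ∀ u v → u ≈ v → expX u ≡ expX v × expY u ≡ expY v
  normal-form-cong (i , j) (k , l) u≈v = from-lattice (InL⇒InLattice u≈v)
    where
      from-lattice : InLattice (k - i) (l - j) → expX (i , j) ≡ expX (k , l) × expY (i , j) ≡ expY (k , l)
      from-lattice (n , m , k-i≡ , l-j≡) = sym (trans (cong (_%ℕ (C ℕ.* W)) (begin
          k + l /ℕ A * + E                         ≡⟨ cong (λ q → k + q * + E) (proj₂ l-divmod) ⟩
          k + (j /ℕ A + m) * + E                   ≡⟨ regroupˣ i k (j /ℕ A) m (+ E) ⟩
          i + j /ℕ A * + E + ((k - i) + m * + E)   ≡⟨ cong₂ (λ s z → i + j /ℕ A * + E + (s + m * z)) k-i≡ +E≡ ⟩
          i + j /ℕ A * + E + ((n * + C - m * + e) * + W + m * (+ e * + W))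
                                                   ≡⟨ cong (λ z → i + j /ℕ A * + E + z) (regroupᴸ n m (+ C) (+ e) (+ W)) ⟩
          i + j /ℕ A * + E + n * (+ C * + W)       ≡⟨ cong (λ z → i + j /ℕ A * + E + n * z) (pos-* C W) ⟨
          i + j /ℕ A * + E + n * + (C ℕ.* W)       ∎))
        ([i+k*d]%ℕd≡i%ℕd (i + j /ℕ A * + E) n (C ℕ.* W))) ,
        sym (proj₁ l-divmod)
        where
          open ≡-Reasoning
          regroupˣ : ∀ i k q m E → k + (q + m) * E ≡ i + q * E + ((k - i) + m * E)
          regroupˣ = solve-∀
          regroupᴸ : ∀ n m c e w → (n * c - m * e) * w + m * (e * w) ≡ n * (c * w)
          regroupᴸ = solve-∀
          regroupʸ : ∀ j l r q m a → j ≡ r + q * a → l - j ≡ m * a → l ≡ r + (q + m) * a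
          regroupʸ j l r q m a j≡ l-j≡ = trans (shift j l) (trans (cong₂ _+_ j≡ l-j≡) (collect r q m a))
            where
              shift : ∀ j l → l ≡ j + (l - j)
              shift = solve-∀
              collect : ∀ r q m a → r + q * a + m * a ≡ r + (q + m) * a
              collect = solve-∀
          l-divmod : (l %ℕ A ≡ j %ℕ A) × (l /ℕ A ≡ j /ℕ A + m)
          l-divmod = divmod-unique l A (j %ℕ A) (j /ℕ A + m) (n%ℕd<d j A)
                       (regroupʸ j l (+ (j %ℕ A)) (j /ℕ A) m (+ A) (a≡a%ℕn+[a/ℕn]*n j A) l-j≡)

  normal-form-injective : ∀ u v → expX u ≡ expX v → expY u ≡ expY v → u ≈ v
  normal-form-injective (i , j) (k , l) X≡ Y≡ = InLattice⇒InL (t , δ , k-i≡ , l-j≡)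
    where
      open ≡-Reasoning
      Xᵤ Xᵥ : ℤ
      Xᵤ = i + j /ℕ A * + E
      Xᵥ = k + l /ℕ A * + E
      δ t : ℤ
      δ = l /ℕ A - j /ℕ A
      t = Xᵥ /ℕ (C ℕ.* W) - Xᵤ /ℕ (C ℕ.* W)
      regroupᵗ : ∀ j l δ a → l ≡ j + δ * a → l - j ≡ δ * a
      regroupᵗ j l δ a l≡ = trans (cong (_- j) l≡) (cancel j (δ * a))
        where
          cancel : ∀ j d → j + d - j ≡ d
          cancel = solve-∀
      regroupˢ : ∀ i k qᵤ qᵥ t c e w → k + qᵥ * (e * w) ≡ i + qᵤ * (e * w) + t * (c * w) →
                 k - i ≡ (t * c - (qᵥ - qᵤ) * e) * w
      regroupˢ i k qᵤ qᵥ t c e w eq =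
        trans (isolate i k qᵥ e w) (trans (cong (λ z → z - qᵥ * (e * w) - i) eq) (collect i qᵤ qᵥ t c e w))
        where
          isolate : ∀ i k qᵥ e w → k - i ≡ k + qᵥ * (e * w) - qᵥ * (e * w) - i
          isolate = solve-∀
          collect : ∀ i qᵤ qᵥ t c e w → i + qᵤ * (e * w) + t * (c * w) - qᵥ * (e * w) - i ≡ (t * c - (qᵥ - qᵤ) * e) * w
          collect = solve-∀
      l-j≡ : l - j ≡ δ * + A
      l-j≡ = regroupᵗ j l δ (+ A) (%ℕ-≡⇒j≡i+[j/d-i/d]*d j l A Y≡)
      k-i≡ : k - i ≡ (t * + C - δ * + e) * + W
      k-i≡ = regroupˢ i k (j /ℕ A) (l /ℕ A) t (+ C) (+ e) (+ W) (begin
        k + l /ℕ A * (+ e * + W)               ≡⟨ cong (λ z → k + l /ℕ A * z) +E≡ ⟨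
        Xᵥ                                     ≡⟨ %ℕ-≡⇒j≡i+[j/d-i/d]*d Xᵤ Xᵥ (C ℕ.* W) X≡ ⟩
        Xᵤ + t * + (C ℕ.* W)                   ≡⟨ cong₂ (λ z w → i + j /ℕ A * z + t * w) +E≡ (pos-* C W) ⟩
        i + j /ℕ A * (+ e * + W) + t * (+ C * + W) ∎)

  normal-form-canonical : ∀ {a r} → a ℕ.< C ℕ.* W → r ℕ.< A → expX (+ a , + r) ≡ a × expY (+ a , + r) ≡ r
  normal-form-canonical {a} {r} a< r< =
    trans (cong (λ q → (+ a + q * + E) %ℕ (C ℕ.* W)) (n<d⇒+n/ℕd≡0 r<))
          (trans (cong (_%ℕ (C ℕ.* W)) (+-identityʳ (+ a))) (n<d⇒+n%ℕd≡n a<)) ,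
    n<d⇒+n%ℕd≡n r<

  expX< : ∀ u → expX u ℕ.< C ℕ.* W
  expX< (i , j) = n%ℕd<d (i + j /ℕ A * + E) (C ℕ.* W)

  expY< : ∀ u → expY u ℕ.< A
  expY< (i , j) = n%ℕd<d j A

  expXᶠ : Carrier → Fin (C ℕ.* W)
  expXᶠ u = fromℕ< (expX< u)

  expYᶠ : Carrier → Fin A
  expYᶠ u = fromℕ< (expY< u)

  expXᶠ-injective : ∀ u v → expXᶠ u ≡ expXᶠ v → expX u ≡ expX v
  expXᶠ-injective u v = Fin.fromℕ<-injective (expX u) (expX v) (expX< u) (expX< v)

  expYᶠ-injective : ∀ u v → expYᶠ u ≡ expYᶠ v → expY u ≡ expY v
  expYᶠ-injective u v = Fin.fromℕ<-injective (expY u) (expY v) (expY< u) (expY< v)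

  expXᶠ-cong : ∀ u v → expX u ≡ expX v → expXᶠ u ≡ expXᶠ v
  expXᶠ-cong u v eq = Fin.fromℕ<-cong (expX u) (expX v) eq (expX< u) (expX< v)

  expYᶠ-cong : ∀ u v → expY u ≡ expY v → expYᶠ u ≡ expYᶠ v
  expYᶠ-cong u v eq = Fin.fromℕ<-cong (expY u) (expY v) eq (expY< u) (expY< v)

  canonical : Fin (C ℕ.* W) → Fin A → Carrier
  canonical a r = (+ toℕ a , + toℕ r)

  expXᶠ-canonical : ∀ a r → expXᶠ (canonical a r) ≡ a
  expXᶠ-canonical a r = Fin.toℕ-injective (trans (Fin.toℕ-fromℕ< (expX< (canonical a r)))
    (proj₁ (normal-form-canonical (Fin.toℕ<n a) (Fin.toℕ<n r))))

  expYᶠ-canonical : ∀ a r → expYᶠ (canonical a r) ≡ r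
  expYᶠ-canonical a r = Fin.toℕ-injective (trans (Fin.toℕ-fromℕ< (expY< (canonical a r)))
    (proj₂ (normal-form-canonical (Fin.toℕ<n a) (Fin.toℕ<n r))))

  cardinality : HasCard (C ℕ.* W ℕ.* A)
  cardinality = (λ u _ → combine (expXᶠ u) (expYᶠ u)) ,
    (λ u v _ _ → (λ eq → normal-form-injective u v
                    (expXᶠ-injective u v (Fin.combine-injectiveˡ (expXᶠ u) (expYᶠ u) (expXᶠ v) (expYᶠ v) eq))
                    (expYᶠ-injective u v (Fin.combine-injectiveʳ (expXᶠ u) (expYᶠ u) (expXᶠ v) (expYᶠ v) eq))) ,
                 (λ u≈v → let X≡ , Y≡ = normal-form-cong u v u≈v in
                    cong₂ combine (expXᶠ-cong u v X≡) (expYᶠ-cong u v Y≡))) ,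
    λ f → let a , r = remQuot {C ℕ.* W} A f in
      canonical a r , tt ,
      trans (cong₂ combine (expXᶠ-canonical a r) (expYᶠ-canonical a r)) (Fin.combine-remQuot {C ℕ.* W} A f)

  InCyc-x⇒ : ∀ g → InCyc x g → Σ ℤ λ z → g ≈ (z , 0ℤ)
  InCyc-x⇒ g (k , inj₁ g≈xᵏ)   = + k , subst (g ≈_) (x^≡ k) g≈xᵏ
  InCyc-x⇒ g (k , inj₂ g≈x⁻ᵏ) = - + k , subst (λ h → g ≈ h ⁻¹) (x^≡ k) g≈x⁻ᵏ

  InCyc-x⇐ : ∀ g z → g ≈ (z , 0ℤ) → InCyc x g
  InCyc-x⇐ g (+ n)    g≈ = n , inj₁ (subst (g ≈_) (sym (x^≡ n)) g≈)
  InCyc-x⇐ g -[1+ n ] g≈ = ℕ.suc n , inj₂ (subst (λ h → g ≈ h ⁻¹) (sym (x^≡ (ℕ.suc n))) g≈)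

  InCyc-y⇒ : ∀ g → InCyc y g → Σ ℤ λ z → g ≈ (0ℤ , z)
  InCyc-y⇒ g (k , inj₁ g≈yᵏ)   = + k , subst (g ≈_) (y^≡ k) g≈yᵏ
  InCyc-y⇒ g (k , inj₂ g≈y⁻ᵏ) = - + k , subst (λ h → g ≈ h ⁻¹) (y^≡ k) g≈y⁻ᵏ

  InCyc-y⇐ : ∀ g z → g ≈ (0ℤ , z) → InCyc y g
  InCyc-y⇐ g (+ n)    g≈ = n , inj₁ (subst (g ≈_) (sym (y^≡ n)) g≈)
  InCyc-y⇐ g -[1+ n ] g≈ = ℕ.suc n , inj₂ (subst (λ h → g ≈ h ⁻¹) (sym (y^≡ (ℕ.suc n))) g≈)

  private
    -[-a+b]≡ : ∀ {a b c} → 0ℤ - (- a + b) ≡ c → b ≡ a + (- c)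
    -[-a+b]≡ {a} {b} {c} eq = trans (shift a b) (cong (λ z → a + (- z)) eq)
      where
        shift : ∀ a b → b ≡ a + (- (0ℤ - (- a + b)))
        shift = solve-∀

  SameCoset-x⇒expY≡ : ∀ u v → SameCoset x u v → expY u ≡ expY v
  SameCoset-x⇒expY≡ (i , j) (k , l) coset with InCyc-x⇒ _ coset
  ... | z , g≈ = from-lattice (InL⇒InLattice g≈)
    where
      from-lattice : InLattice (z - (- i + k)) (0ℤ - (- j + l)) → j %ℕ A ≡ l %ℕ A
      from-lattice (_ , m , _ , ≡mA) = sym (trans
        (cong (_%ℕ A) (trans (-[-a+b]≡ {j} {l} ≡mA) (cong (λ z → j + z) (neg-distribˡ-* m (+ A)))))
        ([i+k*d]%ℕd≡i%ℕd j (- m) A))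

  expY≡⇒SameCoset-x : ∀ u v → expY u ≡ expY v → SameCoset x u v
  expY≡⇒SameCoset-x (i , j) (k , l) Y≡ = InCyc-x⇐ _ ((- i + k) + δ * + E) (InLattice⇒InL (0ℤ , - δ ,
      trans (cancel (- i + k) (δ * + E)) (trans (cong (δ *_) +E≡) (regroupˢ δ (+ C) (+ e) (+ W))) ,
      trans (cong (λ l → 0ℤ - (- j + l)) l≡) (regroupᵗ j δ (+ A))))
    where
      δ : ℤ
      δ = l /ℕ A - j /ℕ A
      l≡ : l ≡ j + δ * + A
      l≡ = %ℕ-≡⇒j≡i+[j/d-i/d]*d j l A Y≡
      cancel : ∀ a b → a + b - a ≡ b
      cancel = solve-∀
      regroupˢ : ∀ δ c e w → δ * (e * w) ≡ (0ℤ * c - (- δ) * e) * w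
      regroupˢ = solve-∀
      regroupᵗ : ∀ j δ a → 0ℤ - (- j + (j + δ * a)) ≡ (- δ) * a
      regroupᵗ = solve-∀

  SameCoset-y⇒%W≡ : ∀ u v → SameCoset y u v → proj₁ u %ℕ W ≡ proj₁ v %ℕ W
  SameCoset-y⇒%W≡ (i , j) (k , l) coset with InCyc-y⇒ _ coset
  ... | z , g≈ = from-lattice (InL⇒InLattice g≈)
    where
      from-lattice : InLattice (0ℤ - (- i + k)) (z - (- j + l)) → i %ℕ W ≡ k %ℕ W
      from-lattice (n , m , ≡W , _) = sym (trans
        (cong (_%ℕ W) (trans (-[-a+b]≡ {i} {k} ≡W) (cong (λ z → i + z) (neg-distribˡ-* (n * + C - m * + e) (+ W)))))
        ([i+k*d]%ℕd≡i%ℕd i (- (n * + C - m * + e)) W))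

  %W≡⇒SameCoset-y : Coprime e C → ∀ u v → proj₁ u %ℕ W ≡ proj₁ v %ℕ W → SameCoset y u v
  %W≡⇒SameCoset-y e⊥C (i , j) (k , l) W≡ with coprime⇒bézout e⊥C
  ... | α , β , bézout = InCyc-y⇐ _ ((- j + l) + m * + A) (InLattice⇒InL (- δ * α , m ,
      (begin
        0ℤ - (- i + k)                            ≡⟨ cong (λ k → 0ℤ - (- i + k)) k≡ ⟩
        0ℤ - (- i + (i + δ * + W))                ≡⟨ regroup₁ i δ (+ W) ⟩
        - δ * + W * 1ℤ                            ≡⟨ cong (- δ * + W *_) bézout ⟨
        - δ * + W * (α * + C - β * + e)           ≡⟨ regroup₂ δ α β (+ C) (+ e) (+ W) ⟩
        ((- δ * α) * + C - m * + e) * + W         ∎) ,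
      cancel (- j + l) (m * + A)))
    where
      open ≡-Reasoning
      δ m : ℤ
      δ = k /ℕ W - i /ℕ W
      m = - δ * β
      k≡ : k ≡ i + δ * + W
      k≡ = %ℕ-≡⇒j≡i+[j/d-i/d]*d i k W W≡
      cancel : ∀ a b → a + b - a ≡ b
      cancel = solve-∀
      regroup₁ : ∀ i δ w → 0ℤ - (- i + (i + δ * w)) ≡ - δ * w * 1ℤ
      regroup₁ = solve-∀
      regroup₂ : ∀ δ α β c e w → - δ * w * (α * c - β * e) ≡ ((- δ * α) * c - (- δ * β) * e) * w
      regroup₂ = solve-∀

  -- W divides P and E, so expX mod W is i mod W, the white vertex; expX div W indexes the C edges
  -- joining a given black and white vertex.
  whiteᶠ : Carrier → Fin W
  whiteᶠ u = remainder {C} W (expXᶠ u)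

  edgeᶠ : Carrier → Fin C
  edgeᶠ u = quotient {C} W (expXᶠ u)

  combine-edge-white : ∀ u → combine (edgeᶠ u) (whiteᶠ u) ≡ expXᶠ u
  combine-edge-white u = Fin.combine-remQuot {C} W (expXᶠ u)

  toℕ-whiteᶠ : ∀ u → toℕ (whiteᶠ u) ≡ proj₁ u %ℕ W
  toℕ-whiteᶠ (i , j) = sym (proj₁ (divmod-unique i W w (+ q + T * + C - qʸ * + e) (Fin.toℕ<n (whiteᶠ u)) (begin
    i                                                   ≡⟨ isolate i qʸ (+ E) ⟩
    (i + qʸ * + E) - qʸ * + E                             ≡⟨ cong₂ (λ a b → a - qʸ * b) (a≡a%ℕn+[a/ℕn]*n (i + qʸ * + E) (C ℕ.* W)) +E≡ ⟩
    (+ expX u + T * + (C ℕ.* W)) - qʸ * (+ e * + W)      ≡⟨ cong₂ (λ a b → (+ a + T * b) - qʸ * (+ e * + W)) expX≡ (pos-* C W) ⟩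
    (+ (W ℕ.* q ℕ.+ w) + T * (+ C * + W)) - qʸ * (+ e * + W)
                 ≡⟨ cong (λ a → (a + T * (+ C * + W)) - qʸ * (+ e * + W)) (trans (pos-+ (W ℕ.* q) w) (cong (_+ + w) (pos-* W q))) ⟩
    (+ W * + q + + w + T * (+ C * + W)) - qʸ * (+ e * + W) ≡⟨ regroup (+ W) (+ q) (+ w) T (+ C) qʸ (+ e) ⟩
    + w + (+ q + T * + C - qʸ * + e) * + W                ∎)))
    where
      open ≡-Reasoning
      u : Carrier
      u = (i , j)
      w q : ℕ
      w = toℕ (whiteᶠ u)
      q = toℕ (edgeᶠ u)
      qʸ T : ℤ
      qʸ = j /ℕ A
      T = (i + qʸ * + E) /ℕ (C ℕ.* W)
      expX≡ : expX u ≡ W ℕ.* q ℕ.+ w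
      expX≡ = trans (sym (Fin.toℕ-fromℕ< (expX< u)))
                (trans (cong toℕ (sym (combine-edge-white u))) (Fin.toℕ-combine (edgeᶠ u) (whiteᶠ u)))
      isolate : ∀ i qʸ E → i ≡ (i + qʸ * E) - qʸ * E
      isolate = solve-∀
      regroup : ∀ w q r T c qʸ e → (w * q + r + T * (c * w)) - qʸ * (e * w) ≡ r + (q + T * c - qʸ * e) * w
      regroup = solve-∀

  underlying-graph : Coprime e C → CompleteBip x y A W C
  underlying-graph e⊥C = black , white , edges
    where
      black : Count (SameCoset x) (λ _ → ⊤) A
      black = (λ u _ → expYᶠ u) ,
        (λ u v _ _ → (λ eq → expY≡⇒SameCoset-x u v (expYᶠ-injective u v eq)) ,
                     (λ coset → expYᶠ-cong u v (SameCoset-x⇒expY≡ u v coset))) ,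
        λ r → (0ℤ , + toℕ r) , tt ,
          Fin.toℕ-injective (trans (Fin.toℕ-fromℕ< (expY< (0ℤ , + toℕ r))) (n<d⇒+n%ℕd≡n (Fin.toℕ<n r)))

      white : Count (SameCoset y) (λ _ → ⊤) W
      white = (λ u _ → whiteᶠ u) ,
        (λ u v _ _ → (λ eq → %W≡⇒SameCoset-y e⊥C u v (trans (sym (toℕ-whiteᶠ u)) (trans (cong toℕ eq) (toℕ-whiteᶠ v)))) ,
                     (λ coset → Fin.toℕ-injective
                        (trans (toℕ-whiteᶠ u) (trans (SameCoset-y⇒%W≡ u v coset) (sym (toℕ-whiteᶠ v)))))) ,
        λ w → (+ toℕ w , 0ℤ) , tt ,
          Fin.toℕ-injective (trans (toℕ-whiteᶠ (+ toℕ w , 0ℤ)) (n<d⇒+n%ℕd≡n (Fin.toℕ<n w)))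

      edges : ∀ r w → Count _≈_ (λ h → (expYᶠ h ≡ r) × (whiteᶠ h ≡ w)) C
      edges r w = (λ u _ → edgeᶠ u) ,
        (λ u v (Yᵤ , Wᵤ) (Yᵥ , Wᵥ) →
          (λ eq → normal-form-injective u v
             (expXᶠ-injective u v (begin
               expXᶠ u                          ≡⟨ combine-edge-white u ⟨
               combine (edgeᶠ u) (whiteᶠ u)     ≡⟨ cong₂ combine eq (trans Wᵤ (sym Wᵥ)) ⟩
               combine (edgeᶠ v) (whiteᶠ v)     ≡⟨ combine-edge-white v ⟩
               expXᶠ v                          ∎))
             (expYᶠ-injective u v (trans Yᵤ (sym Yᵥ)))) ,
          (λ u≈v → cong (quotient {C} W) (expXᶠ-cong u v (proj₁ (normal-form-cong u v u≈v))))) ,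
        λ t → canonical (combine t w) r ,
          (expYᶠ-canonical (combine t w) r ,
           trans (cong (remainder {C} W) (expXᶠ-canonical (combine t w) r)) (cong proj₂ (Fin.remQuot-combine t w))) ,
          trans (cong (quotient {C} W) (expXᶠ-canonical (combine t w) r)) (cong proj₁ (Fin.remQuot-combine t w))
        where open ≡-Reasoning

  module OrderXY (d N′ M′ : ℕ) {{d≢0 : ℕ.NonZero d}} (CS≡dN′ : C ℕ.* S ≡ d ℕ.* N′)
                 (1+eS≡dM′ : ℕ.suc (e ℕ.* S) ≡ d ℕ.* M′) (N′⊥M′ : Coprime N′ M′) where

    +CS≡ : + C * + S ≡ + d * + N′
    +CS≡ = trans (sym (pos-* C S)) (trans (cong +_ CS≡dN′) (pos-* d N′))

    +1+eS≡ : 1ℤ + + e * + S ≡ + d * + M′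
    +1+eS≡ = trans (cong (λ z → 1ℤ + z) (sym (pos-* e S)))
               (trans (sym (pos-+ 1 (e ℕ.* S))) (trans (cong +_ 1+eS≡dM′) (pos-* d M′)))

    instance
      N′≢0 : ℕ.NonZero N′
      N′≢0 = ℕ.≢-nonZero λ N′≡0 → ℕ.≢-nonZero⁻¹ (C ℕ.* S) {{ℕ.m*n≢0 C S}}
               (trans CS≡dN′ (trans (cong (d ℕ.*_) N′≡0) (ℕ.*-zeroʳ d)))

    [xy]ᴬᴺ′≈ε : (x ∙ y) ^ (A ℕ.* N′) ≈ ε
    [xy]ᴬᴺ′≈ε = subst (_≈ ε) (sym ([xy]^≡ (A ℕ.* N′)))
      (InLattice⇒≈ε (+ (A ℕ.* N′)) (+ (A ℕ.* N′)) (- + M′ , - + N′ ,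
        *-cancelˡ-≡ (+ d) _ _ d*-AN′≡ , trans (cong -_ (pos-* A N′)) (regroupᵗ (+ A) (+ N′))))
      where
        open ≡-Reasoning
        regroupᵗ : ∀ a n → - (a * n) ≡ (- n) * a
        regroupᵗ = solve-∀
        regroup₁ : ∀ a d n → d * (- (a * n)) ≡ - (a * (d * n))
        regroup₁ = solve-∀
        regroup₂ : ∀ a c s e → - (a * (c * s)) ≡ a * (- ((1ℤ + e * s) * c * s) + (c * s) * e * s)
        regroup₂ = solve-∀
        regroup₃ : ∀ a c s e d m n → a * (- ((d * m) * c * s) + (d * n) * e * s) ≡ d * (((- m) * c - (- n) * e) * (a * s))
        regroup₃ = solve-∀
        d*-AN′≡ : + d * - + (A ℕ.* N′) ≡ + d * ((- + M′ * + C - - + N′ * + e) * + W)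
        d*-AN′≡ = begin
          + d * - + (A ℕ.* N′)                                           ≡⟨ cong (λ z → + d * - z) (pos-* A N′) ⟩
          + d * - (+ A * + N′)                                           ≡⟨ regroup₁ (+ A) (+ d) (+ N′) ⟩
          - (+ A * (+ d * + N′))                                         ≡⟨ cong (λ z → - (+ A * z)) +CS≡ ⟨
          - (+ A * (+ C * + S))                                          ≡⟨ regroup₂ (+ A) (+ C) (+ S) (+ e) ⟩
          + A * (- ((1ℤ + + e * + S) * + C * + S) + (+ C * + S) * + e * + S)
                                       ≡⟨ cong₂ (λ u v → + A * (- (u * + C * + S) + v * + e * + S)) +1+eS≡ +CS≡ ⟩
          + A * (- ((+ d * + M′) * + C * + S) + (+ d * + N′) * + e * + S) ≡⟨ regroup₃ (+ A) (+ C) (+ S) (+ e) (+ d) (+ M′) (+ N′) ⟩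
          + d * ((- + M′ * + C - - + N′ * + e) * (+ A * + S))             ≡⟨ cong (λ w → + d * ((- + M′ * + C - - + N′ * + e) * w)) +W≡ ⟨
          + d * ((- + M′ * + C - - + N′ * + e) * + W)                     ∎

    [xy]ᵏ≈ε⇒AN′∣k : ∀ k → (x ∙ y) ^ k ≈ ε → A ℕ.* N′ ℕ.∣ k
    [xy]ᵏ≈ε⇒AN′∣k k [xy]ᵏ≈ε with ≈ε⇒InLattice (+ k) (+ k) (subst (_≈ ε) ([xy]^≡ k) [xy]ᵏ≈ε)
    ... | n , m , -k≡ , -k≡mA = -k≡q*d⇒d∣k q (begin
      - + k             ≡⟨ -k≡mA ⟩
      m * + A           ≡⟨ cong (_* + A) m≡qN′ ⟩
      q * + N′ * + A    ≡⟨ regroup q (+ N′) (+ A) ⟩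
      q * (+ A * + N′)  ≡⟨ cong (q *_) (pos-* A N′) ⟨
      q * + (A ℕ.* N′)  ∎)
      where
        open ≡-Reasoning
        regroup : ∀ q n a → q * n * a ≡ q * (a * n)
        regroup = solve-∀
        regroupˢ : ∀ u a s → u * (a * s) ≡ (u * s) * a
        regroupˢ = solve-∀
        regroup₁ : ∀ m d M → d * (m * M) ≡ m * (d * M)
        regroup₁ = solve-∀
        regroup₂ : ∀ m e s → m * (1ℤ + e * s) ≡ m + m * e * s
        regroup₂ = solve-∀
        regroup₃ : ∀ n c m e s → (n * c - m * e) * s + m * e * s ≡ n * (c * s)
        regroup₃ = solve-∀
        regroup₄ : ∀ n d N → n * (d * N) ≡ d * (n * N)
        regroup₄ = solve-∀
        m≡ : m ≡ (n * + C - m * + e) * + S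
        m≡ = *-cancelʳ-≡ m _ (+ A) (begin
          m * + A                         ≡⟨ trans (sym -k≡mA) -k≡ ⟩
          (n * + C - m * + e) * + W       ≡⟨ cong ((n * + C - m * + e) *_) +W≡ ⟩
          (n * + C - m * + e) * (+ A * + S) ≡⟨ regroupˢ (n * + C - m * + e) (+ A) (+ S) ⟩
          (n * + C - m * + e) * + S * + A ∎)
        mM′≡nN′ : m * + M′ ≡ n * + N′
        mM′≡nN′ = *-cancelˡ-≡ (+ d) _ _ (begin
          + d * (m * + M′)                       ≡⟨ regroup₁ m (+ d) (+ M′) ⟩
          m * (+ d * + M′)                       ≡⟨ cong (m *_) +1+eS≡ ⟨
          m * (1ℤ + + e * + S)                   ≡⟨ regroup₂ m (+ e) (+ S) ⟩
          m + m * + e * + S                      ≡⟨ cong (_+ m * + e * + S) m≡ ⟩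
          (n * + C - m * + e) * + S + m * + e * + S ≡⟨ regroup₃ n (+ C) m (+ e) (+ S) ⟩
          n * (+ C * + S)                        ≡⟨ cong (n *_) +CS≡ ⟩
          n * (+ d * + N′)                       ≡⟨ regroup₄ n (+ d) (+ N′) ⟩
          + d * (n * + N′)                       ∎)
        N′∣m : + N′ Signed.∣ m
        N′∣m = ∣ᵤ⇒∣ (ℤ.coprime-divisor (+ N′) (+ M′) m N′⊥M′
                 (∣⇒∣ᵤ (divides n (trans (*-comm (+ M′) m) mM′≡nN′))))
        q : ℤ
        q = Signed._∣_.quotient N′∣m
        m≡qN′ : m ≡ q * + N′
        m≡qN′ = Signed._∣_.equality N′∣m

    order-xy : IsOrder (x ∙ y) (A ℕ.* N′)
    order-xy = isOrder-from-∣ (ℕ.>-nonZero⁻¹ (A ℕ.* N′) {{ℕ.m*n≢0 A N′}}) [xy]ᴬᴺ′≈ε [xy]ᵏ≈ε⇒AN′∣k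

    genus : Coprime e C → 2 ℕ.∣ A ℕ.* (P ℕ.+ S ℕ.+ d ℕ.+ 1) →
            Σ ℤ λ g → HasGenus x y g × (+ 2 * g ≡ + 2 + + A * (+ P - + S - + d - + 1))
    genus e⊥C 2∣numerator with even-numerator⇒genus A P S d 2∣numerator
    ... | g , 2g≡ = g , (C ℕ.* W ℕ.* A , P , Q , A ℕ.* N′ ,
                         cardinality , order-x , order-y e⊥C , order-xy ,
                         genus-formula (+ A) (+ C) (+ S) (+ d) (+ N′) g +P≡′ +Q≡ (pos-* A N′) +CWA≡ +CS≡ 2g≡) ,
                    2g≡
      where
        +P≡′ : + P ≡ + C * (+ A * + S)
        +P≡′ = trans +P≡ (cong (+ C *_) +W≡)
        +CWA≡ : + (C ℕ.* W ℕ.* A) ≡ + P * + A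
        +CWA≡ = trans (pos-* (C ℕ.* W) A) (cong (λ z → + z * + A) (sym P≡))

module ExponentArithmetic where
  open import Data.Nat.Base
  open import Data.Nat.Properties
  open import Data.Sum using (inj₁; inj₂)
  open import Data.Empty using (⊥-elim)
  open import Function.Bundles using (_⇔_; mk⇔)
  open import Relation.Binary.PropositionalEquality

  ≡⇔^∸≡1 : ∀ {p m n} → 1 < p → m ≤ n → (m ≡ n ⇔ p ^ (n ∸ m) ≡ 1)
  ≡⇔^∸≡1 {p} {m} {n} 1<p m≤n = mk⇔ (λ { refl → cong (p ^_) (n∸n≡0 n) }) from
    where
      from : p ^ (n ∸ m) ≡ 1 → m ≡ n
      from pⁿ⁻ᵐ≡1 with m^n≡1⇒n≡0∨m≡1 p (n ∸ m) pⁿ⁻ᵐ≡1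
      ... | inj₁ n∸m≡0 = ≤-antisym m≤n (m∸n≡0⇒m≤n n∸m≡0)
      ... | inj₂ p≡1   = ⊥-elim (<-irrefl (sym p≡1) 1<p)

module PowerParameters (p a b c e : ℕ) {{p≢0 : ℕ.NonZero p}} (a≤b : a ℕ.≤ b) (c≤b-a : c ℕ.≤ b ℕ.∸ a) where
  open import Data.Nat.Base
  open import Data.Nat.Properties
  open import Data.Nat.DivMod using (_/_; m*[n/m]≡n; *-/-assoc)
  open import Data.Nat.GCD using (gcd[m,n]∣m; gcd[m,n]∣n)
  open import Data.Nat.Coprimality using (Coprime; coprime-/gcd)
  open import Relation.Binary.PropositionalEquality

  s d : ℕ
  s = b ∸ a ∸ c
  d = dOf p a b c e

  instance
    pᵃ≢0 : NonZero (p ^ a)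
    pᵃ≢0 = m^n≢0 p a
    pᶜ≢0 : NonZero (p ^ c)
    pᶜ≢0 = m^n≢0 p c
    pˢ≢0 : NonZero (p ^ s)
    pˢ≢0 = m^n≢0 p s
    d≢0 : NonZero d
    d≢0 = dOf-nonZero p a b c e

  N′ M′ : ℕ
  N′ = p ^ (b ∸ a) / d
  M′ = suc (e * p ^ s) / d

  b∸a≡c+s : b ∸ a ≡ c + s
  b∸a≡c+s = sym (m+[n∸m]≡n c≤b-a)

  b≡c+[a+s] : b ≡ c + (a + s)
  b≡c+[a+s] = begin
    b               ≡⟨ m+[n∸m]≡n a≤b ⟨
    a + (b ∸ a)     ≡⟨ cong (a +_) b∸a≡c+s ⟩
    a + (c + s)     ≡⟨ +-assoc a c s ⟨
    a + c + s       ≡⟨ cong (_+ s) (+-comm a c) ⟩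
    c + a + s       ≡⟨ +-assoc c a s ⟩
    c + (a + s)     ∎
    where open ≡-Reasoning

  pᵇ≡ : p ^ b ≡ p ^ c * (p ^ a * p ^ s)
  pᵇ≡ = trans (cong (p ^_) b≡c+[a+s]) (trans (^-distribˡ-+-* p c (a + s)) (cong (p ^ c *_) (^-distribˡ-+-* p a s)))

  pᵃ⁺ᶜ≡ : p ^ (a + c) ≡ p ^ a * p ^ c
  pᵃ⁺ᶜ≡ = ^-distribˡ-+-* p a c

  pᵇ⁻ᶜ≡ : p ^ (b ∸ c) ≡ p ^ a * p ^ s
  pᵇ⁻ᶜ≡ = trans (cong (λ k → p ^ (k ∸ c)) b≡c+[a+s]) (trans (cong (p ^_) (m+n∸m≡n c (a + s))) (^-distribˡ-+-* p a s))

  pᵇ⁻ᵃ≡ : p ^ (b ∸ a) ≡ p ^ c * p ^ s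
  pᵇ⁻ᵃ≡ = trans (cong (p ^_) b∸a≡c+s) (^-distribˡ-+-* p c s)

  CS≡dN′ : p ^ c * p ^ s ≡ d * N′
  CS≡dN′ = trans (sym pᵇ⁻ᵃ≡) (sym (m*[n/m]≡n (gcd[m,n]∣m (p ^ (b ∸ a)) (suc (e * p ^ s)))))

  1+eS≡dM′ : suc (e * p ^ s) ≡ d * M′
  1+eS≡dM′ = sym (m*[n/m]≡n (gcd[m,n]∣n (p ^ (b ∸ a)) (suc (e * p ^ s))))

  N′⊥M′ : Coprime N′ M′
  N′⊥M′ = coprime-/gcd (p ^ (b ∸ a)) (suc (e * p ^ s))

  orderXY≡pᵃN′ : orderXY p a b c e ≡ p ^ a * N′
  orderXY≡pᵃN′ = trans (cong (_/ d) (trans (cong (p ^_) (sym (m+[n∸m]≡n a≤b))) (^-distribˡ-+-* p a (b ∸ a))))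
                       (*-/-assoc (p ^ a) (gcd[m,n]∣m (p ^ (b ∸ a)) (suc (e * p ^ s))))

  module _ (pˢ≡1 : p ^ s ≡ 1) where

    pᵃpˢ≡pᵃ : p ^ a * p ^ s ≡ p ^ a
    pᵃpˢ≡pᵃ = trans (cong (p ^ a *_) pˢ≡1) (*-identityʳ (p ^ a))

    pᶜ≡pᵇ⁻ᵃ : p ^ c ≡ p ^ (b ∸ a)
    pᶜ≡pᵇ⁻ᵃ = sym (trans pᵇ⁻ᵃ≡ (trans (cong (p ^ c *_) pˢ≡1) (*-identityʳ (p ^ c))))

open import Data.Nat using (ℕ; _≤_; _<_; _+_; _*_; _^_; _∸_)
open import Data.Nat.Primality using (Prime)
open import Data.Nat.Coprimality using (Coprime)
open import Data.Integer as ℤ using (ℤ; +_)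
open import Data.Integer.Divisibility using () renaming (_∣_ to _∣ℤ_)
open import Data.Product using (Σ; _×_)
open import Function.Bundles using (_⇔_)
open import Data.Nat.Primality using (prime⇒nonZero; prime⇒nonTrivial)
open import Data.Product using (_,_; proj₁)
open import Data.Product.Function.NonDependent.Propositional using (_×-⇔_)
open import Data.Sum using (inj₁; inj₂)
import Function.Properties.Equivalence as ⇔
open import Relation.Binary.PropositionalEquality using (sym; cong; subst; subst₂)
open ExponentArithmetic using (≡⇔^∸≡1)
open Parity using (genus-numerator-even)

corollary4p9 :
    (p a b c e : ℕ) → Prime p → a ≤ b → c ≤ b ∸ a →
    e < p ^ c → Coprime e (p ^ c) →
    let open Group (DessinGroup p a b c e) using (_∙_)
        open DessinNotions (DessinGroup p a b c e) hiding (_^_)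
        x = genX p a b c e
        y = genY p a b c e
        d = dOf p a b c e
    in Reflexible x y
       × (IsOrder x (p ^ b) × IsOrder y (p ^ (a + c)) × IsOrder (x ∙ y) (orderXY p a b c e))
       × (Σ ℤ λ g → HasGenus x y g
            × (+ 2 ℤ.* g ≡ + 2 ℤ.+ + (p ^ a) ℤ.* (+ (p ^ b) ℤ.- + (p ^ (b ∸ a ∸ c)) ℤ.- + d ℤ.- + 1)))
       × UnderlyingGraphIs x y (p ^ (b ∸ c)) (p ^ a) (p ^ c)
       × (Symmetric x y ⇔ ((c ≡ b ∸ a) × (+ (p ^ c) ∣ℤ (+ (e * e) ℤ.- + 1))))
       × (Symmetric x y → UnderlyingGraphIs x y (p ^ a) (p ^ a) (p ^ (b ∸ a)))
corollary4p9 p a b c e p-prime a≤b c≤b-a _ e⊥pᶜ =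
  reflexible ,
  (order-x , order-y e⊥pᶜ , subst (IsOrder (x ∙ y)) (sym orderXY≡pᵃN′) order-xy) ,
  genus e⊥pᶜ (genus-numerator-even p a b c e c≤b-a e⊥pᶜ) ,
  inj₂ (subst (λ w → CompleteBip x y (p ^ a) w (p ^ c)) (sym pᵇ⁻ᶜ≡) (underlying-graph e⊥pᶜ)) ,
  ⇔.trans (symmetric⇔ e⊥pᶜ) (⇔.sym (≡⇔^∸≡1 (ℕ.nonTrivial⇒n>1 p) c≤b-a) ×-⇔ ⇔.refl) ,
  λ symmetric → let pˢ≡1 = proj₁ (symmetric⇒ e⊥pᶜ symmetric) in
    inj₁ (subst₂ (CompleteBip x y (p ^ a)) (pᵃpˢ≡pᵃ pˢ≡1) (pᶜ≡pᵇ⁻ᵃ pˢ≡1) (underlying-graph e⊥pᶜ))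
  where
    instance
      p≢0 : ℕ.NonZero p
      p≢0 = prime⇒nonZero p-prime
      p-nonTrivial : ℕ.NonTrivial p
      p-nonTrivial = prime⇒nonTrivial p-prime
    open PowerParameters p a b c e a≤b c≤b-a
    open AbelianDessin (p ^ a) (p ^ c) (p ^ s) e pᵇ≡ pᵃ⁺ᶜ≡ (cong (e *_) pᵇ⁻ᶜ≡)
    open OrderXY d N′ M′ CS≡dN′ 1+eS≡dM′ N′⊥M′
    open Group G using (_∙_)
    open DessinNotions G using (IsOrder; CompleteBip)
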